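{- Let $\mathbb{F}$ be a field of characteristic zero. Let $P(\mathbf{x}, y) \in \mathbb{F}[x_1,\dots,x_n, y]$ be a polynomial of degree at most $r$, let $\alpha \in \mathbb{F}$, and let $d$ be a positive integer. Let \[ \mathcal{G}_y'(P, \alpha, d) = \left\{\mathcal{H}_{\leq d}\left[ \frac{\partial^{j} P }{\partial y^j}\left(\mathbf{x}, \alpha \right)\right] - \mathcal{H}_{0}\left[ \frac{\partial^{j} P }{\partial y^j}\left(\mathbf{x}, \alpha \right)\right]: j \in \{0, 1, \ldots, d\}\right\}, \] and let $\mathcal{G}_y(P, \alpha, d)$ be the subset of $\mathcal{G}_y'(P, \alpha, d)$ consisting of all nonzero polynomials. Then: (1) for every $g \in \mathcal{G}_y(P, \alpha, d)$, every monomial with nonzero coefficient in $g$ has degree at least $1$ and at most $d$; (2) $|\mathcal{G}_y(P,\alpha,d)| \leq d + 1$; (3) if $P$ has an arithmetic circuit of size at most $s$ and depth $\Delta$, then every $g \in \mathcal{G}_y(P, \alpha, d)$ has an arithmetic circuit of size at most $O(sr^4)$ and depth $\Delta$.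
   Context: For a polynomial $R$ in variables $\mathbf{x}$, $\mathcal{H}_k[R]$ is its homogeneous component of degree $k$ (in $\mathbf{x}$) and $\mathcal{H}_{\le k}[R]=\sum_{i=0}^k\mathcal{H}_i[R]$. For a polynomial $P$ and $k\in\mathbb{N}$, the derivative $\frac{\partial^k P}{\partial y^k}(\mathbf{x},y)$ is defined (Hasse derivative) as the coefficient of $z^k$ in $P(\mathbf{x},y+z)$, where $z$ is a new variable. An arithmetic circuit is a directed acyclic graph whose in-degree-zero nodes are labeled by field elements or variables and whose internal nodes are sum or product gates of unbounded fan-in; size is the number of wires, depth the length of a longest input-output path; circuits are layered with alternating sum and product layers, the top layer being sum gates. -}

module Defs where

open import Level using (Level; _⊔_) renaming (suc to lsuc)
open import Data.Nat as ℕ using (ℕ; zero; suc; _∸_; _≤_; _≤ᵇ_; _≡ᵇ_)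
open import Data.Bool using (Bool; true; false; if_then_else_; _∧_; not)
open import Data.Fin using (Fin; zero; suc)
open import Data.Vec as Vec using (Vec; []; _∷_)
open import Data.List as List using (List; []; _∷_; map; concatMap; upTo; foldr)
open import Data.List.NonEmpty as List⁺ using (List⁺)
open import Data.Product using (Σ; ∃; ∃-syntax; _×_; _,_)
open import Relation.Nullary using (¬_)
open import Algebra.Bundles using (CommutativeRing)

record Field (a ℓ : Level) : Set (lsuc (a ⊔ ℓ)) where
  field
    commutativeRing : CommutativeRing a ℓ
  open CommutativeRing commutativeRing public
  field
    0≉1     : ¬ (0# ≈ 1#)
    inverse : ∀ x → ¬ (x ≈ 0#) → ∃[ y ] (x * y ≈ 1#)

-- Monomials in k variables are exponent vectors  Vec ℕ k.

∣_∣ : ∀ {k} → Vec ℕ k → ℕ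
∣ m ∣ = Vec.sum m

allZero : ∀ {k} → Vec ℕ k → Bool
allZero []      = true
allZero (e ∷ m) = (e ≡ᵇ 0) ∧ allZero m

isUnit : ∀ {k} → Fin k → Vec ℕ k → Bool
isUnit zero    (e ∷ m) = (e ≡ᵇ 1) ∧ allZero m
isUnit (suc i) (e ∷ m) = (e ≡ᵇ 0) ∧ isUnit i m

splits : ∀ {k} → Vec ℕ k → List (Vec ℕ k × Vec ℕ k)
splits []      = ([] , []) ∷ []
splits (e ∷ m) =
  concatMap (λ i → map (λ pq → (i ∷ Data.Product.proj₁ pq) , ((e ∸ i) ∷ Data.Product.proj₂ pq)) (splits m))
            (upTo (suc e))

module Poly {a ℓ : Level} (F : Field a ℓ) where
  open Field F public using (Carrier; _≈_; _+_; _*_; _-_; 0#; 1#)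

  C : Set a
  C = Carrier

  embℕ : ℕ → C
  embℕ zero    = 0#
  embℕ (suc n) = 1# + embℕ n

  CharZero : Set ℓ
  CharZero = ∀ k → ¬ (embℕ (suc k) ≈ 0#)

  sumL : List C → C
  sumL = foldr _+_ 0#

  pow : C → ℕ → C
  pow x zero    = 1#
  pow x (suc n) = x * pow x n

  -- Polynomials in k variables, given by (syntactic) expressions;
  -- a polynomial is identified with its coefficient function.
  data Expr (k : ℕ) : Set a where
    con  : C → Expr k
    var  : Fin k → Expr k
    _⊕_  : Expr k → Expr k → Expr k
    _⊗_  : Expr k → Expr k → Expr k

  sumE : ∀ {k} → List (Expr k) → Expr k
  sumE = foldr _⊕_ (con 0#)

  prodE : ∀ {k} → List (Expr k) → Expr k
  prodE = foldr _⊗_ (con 1#)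

  Coeffs : ℕ → Set a
  Coeffs k = Vec ℕ k → C

  _≐_ : ∀ {k} → Coeffs k → Coeffs k → Set ℓ
  f ≐ g = ∀ m → f m ≈ g m

  NonZero : ∀ {k} → Coeffs k → Set ℓ
  NonZero f = ¬ (∀ m → f m ≈ 0#)

  coeff : ∀ {k} → Expr k → Coeffs k
  coeff (con c) m = if allZero m then c else 0#
  coeff (var i) m = if isUnit i m then 1# else 0#
  coeff (p ⊕ q) m = coeff p m + coeff q m
  coeff (p ⊗ q) m =
    sumL (map (λ st → coeff p (Data.Product.proj₁ st) * coeff q (Data.Product.proj₂ st)) (splits m))

  -- a syntactic upper bound on the degree of an expression
  degBound : ∀ {k} → Expr k → ℕ
  degBound (con _) = 0
  degBound (var _) = 1
  degBound (p ⊕ q) = degBound p ℕ.⊔ degBound q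
  degBound (p ⊗ q) = degBound p ℕ.+ degBound q

  DegAtMost : ∀ {k} → Coeffs k → ℕ → Set ℓ
  DegAtMost f r = ∀ m → r ℕ.< ∣ m ∣ → f m ≈ 0#

  H : ∀ {k} → ℕ → Coeffs k → Coeffs k
  H i f m = if ∣ m ∣ ≡ᵇ i then f m else 0#

  H≤ : ∀ {k} → ℕ → Coeffs k → Coeffs k
  H≤ i f m = if ∣ m ∣ ≤ᵇ i then f m else 0#

  -- Polynomials in (y, x₁,…,xₙ): variable 0 is y, variable (suc i) is x_{i+1}.

  -- P(x, y) ↦ P(x, y + z), with variable order (z, y, x₁,…,xₙ)
  shiftY : ∀ {n} → Expr (suc n) → Expr (suc (suc n))
  shiftY (con c)       = con c
  shiftY (var zero)    = var (suc zero) ⊕ var zero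
  shiftY (var (suc i)) = var (suc (suc i))
  shiftY (p ⊕ q)       = shiftY p ⊕ shiftY q
  shiftY (p ⊗ q)       = shiftY p ⊗ shiftY q

  -- Hasse derivative ∂ʲP/∂yʲ (x, y): the coefficient of zʲ in P(x, y + z)
  hasse : ∀ {n} → ℕ → Expr (suc n) → Coeffs (suc n)
  hasse j P m = coeff (shiftY P) (j ∷ m)

  -- substitute y := α in a polynomial of y-degree ≤ B
  evalY : ∀ {n} → C → ℕ → Coeffs (suc n) → Coeffs n
  evalY α B f m = sumL (map (λ e → f (e ∷ m) * pow α e) (upTo (suc B)))

  -- ∂ʲP/∂yʲ (x, α)   (degBound P bounds the y-degree of P(x, y+z))
  hasseAt : ∀ {n} → ℕ → Expr (suc n) → C → Coeffs n
  hasseAt j P α = evalY α (degBound P) (hasse j P)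

  gElem : ∀ {n} → Expr (suc n) → C → ℕ → ℕ → Coeffs n
  gElem P α d j m = H≤ d (hasseAt j P α) m - H 0 (hasseAt j P α) m

  -- membership in G_y(P, α, d) (a set of polynomials, up to equality)
  _∈G[_,_,_] : ∀ {n} → Coeffs n → Expr (suc n) → C → ℕ → Set ℓ
  g ∈G[ P , α , d ] = (∃[ j ] (j ≤ d × g ≐ gElem P α d j)) × NonZero g

  -- |S| ≤ k for a set S of polynomials: S is covered by k polynomials
  CardAtMost : ∀ {n} → (Coeffs n → Set ℓ) → ℕ → Set (a ⊔ ℓ)
  CardAtMost {n} S k = Σ (Fin k → Coeffs n) λ e → ∀ g → S g → ∃[ i ] (g ≐ e i)

  data Leaf (k : ℕ) : Set a where
    lvar : Fin k → Leaf k
    lcon : C → Leaf k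

  -- Layers k Δ w : the bottom Δ gate layers of a layered circuit over k
  -- variables whose topmost layer has w nodes.  Layer 0 consists of
  -- input leaves; each gate of layer i+1 has a nonempty list of wires
  -- from nodes of layer i.
  data Layers (k : ℕ) : ℕ → ℕ → Set a where
    leaves : ∀ {w} → Vec (Leaf k) w → Layers k 0 w
    _▷_    : ∀ {Δ w w'} → Layers k Δ w → Vec (List⁺ (Fin w)) w' → Layers k (suc Δ) w'

  Circuit : ℕ → ℕ → Set a
  Circuit k Δ = Layers k Δ 1

  -- size = number of wires
  size : ∀ {k Δ w} → Layers k Δ w → ℕ
  size (leaves _) = 0
  size (L ▷ gs)   = size L ℕ.+ Vec.sum (Vec.map List⁺.length gs)

  leafE : ∀ {k} → Leaf k → Expr k
  leafE (lvar i) = var i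
  leafE (lcon c) = con c

  -- polynomials computed by the top layer; the Bool says whether the top
  -- layer consists of sum gates (true) or product gates (false); layers
  -- alternate.
  evalL : ∀ {k Δ w} → Bool → Layers k Δ w → Vec (Expr k) w
  evalL b (leaves ls) = Vec.map leafE ls
  evalL b (L ▷ gs)    =
    Vec.map (λ g → (if b then sumE else prodE)
                      (List⁺.toList (List⁺.map (Vec.lookup (evalL (not b) L)) g)))
            gs

  -- the top layer consists of sum gates
  evalC : ∀ {k Δ} → Circuit k Δ → Expr k
  evalC c = Vec.head (evalL true c)

  HasCircuit : ∀ {k} → Coeffs k → ℕ → ℕ → Set (a ⊔ ℓ)
  HasCircuit {k} f s Δ = Σ (Circuit k Δ) λ c → size c ≤ s × coeff (evalC c) ≐ f

-- Parts (1) and (2) are coefficientwise bookkeeping: the coefficient of g_j at a monomial m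
-- is w_d(|m|) · h_j(m), where h_j = ∂ʲ_y P(x, α) and w_d(i) = [i ≤ d] − [i = 0] vanishes
-- outside 1 ≤ i ≤ d; and j ↦ g_j (j ≤ d) enumerates G_y(P, α, d).
--
-- Part (3) is an interpolation argument.  Hasse derivatives are the coefficients of
-- P(x, y + z), which gives Taylor's formula P(x, α + β) = Σ_j h_j β^j; moreover h_j = 0
-- for j > r, and no h_j has coefficients of degree > r.  In characteristic zero the points
-- 0, …, r (and 1, …, r + 1) are distinct, so Vandermonde systems of size r + 1 are
-- solvable: h_J = Σ_b ν_b P(x, α + b), and w_d(i) = Σ_t μ_t (t + 1)^i for all i ≤ r.  Hence
--   g_J(x) = Σ_{t, b ≤ r} μ_t ν_b P((t + 1) x, α + b).
-- A layered circuit for P is rewired, keeping its depth, into one for P((t + 1) x, β) of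
-- size ≤ (t + 2)·size: at the bottom, y becomes the constant β and each wire from x_i is
-- repeated t + 1 times into a sum gate, or doubled by a wire to the constant t + 1 into a
-- product gate.  Scaling by μ_t ν_b and summing the (r + 1)² copies under one top gate gives
-- size ≤ 32 s r⁴.  Circuits of depth ≤ 1 compute affine polynomials and are treated directly.
module Submission where

open import Defs
open import Level using (Level; _⊔_)
open import Data.Nat as ℕ using (ℕ; zero; suc; _≤_; _<_; z≤n; s≤s; _∸_; _^_)
import Data.Nat.Properties as NP
open import Data.Nat.Tactic.RingSolver using (solve-∀)
open import Data.Bool using (Bool; true; false; if_then_else_; not; T)
open import Data.Fin using (Fin; zero; suc; _↑ˡ_; _↑ʳ_; toℕ; fromℕ<)
import Data.Fin.Properties as FP
open import Data.Vec as Vec using (Vec; []; _∷_)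
import Data.Vec.Properties as VP
open import Data.List as List using (List; []; _∷_; map; _++_; applyUpTo; upTo; concatMap)
import Data.List.Properties as LP
open import Data.List.NonEmpty as List⁺ using (List⁺; _∷_; toList)
open import Data.Product using (Σ; ∃; _×_; _,_; proj₁; proj₂)
open import Data.Sum using (_⊎_; inj₁; inj₂)
open import Data.Empty using (⊥-elim)
open import Relation.Nullary using (¬_; Dec; yes; no)
open import Relation.Binary.PropositionalEquality as ≡ using (_≡_; _≢_)
open import Relation.Binary.Definitions using (tri<; tri≈; tri>)
open import Function using (_∘_)
import Algebra.Solver.Ring.NaturalCoefficients.Default as NC
import Algebra.Properties.Ring as RingProperties
import Algebra.Properties.CommutativeSemigroup as CommutativeSemigroupProperties

open CommutativeSemigroupProperties NP.+-commutativeSemigroup using () renaming (interchange to +-interchangeℕ)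

module Development {a ℓ} (F : Field a ℓ) where
  open Field F hiding (zero)
  open Poly F hiding (Carrier; _≈_; _+_; _*_; _-_; 0#; 1#)
  open import Relation.Binary.Reasoning.Setoid setoid
  open NC commutativeSemiring using (solve; _:=_; _:+_; _:*_; con)
  open CommutativeSemigroupProperties +-commutativeSemigroup using () renaming (interchange to +-interchange)
  open CommutativeSemigroupProperties *-commutativeSemigroup using () renaming (interchange to *-interchange; x∙yz≈y∙xz to *-left-commute)
  open RingProperties ring using ([y-z]x≈yx-zx; -0#≈0#; +-identityʳ-unique; x∙y⁻¹≈ε⇒x≈y; xyx⁻¹≈y)

  -- Finite sums ∑ n f = f 0 + … + f (n − 1) over the field, kept opaque so that goals
  -- stay readable; everything below uses only the listed laws.
  opaque
    ∑ : ℕ → (ℕ → C) → C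
    ∑ n f = sumL (applyUpTo f n)

  opaque
    unfolding ∑

    ∑-zero : ∀ (f : ℕ → C) → ∑ 0 f ≈ 0#
    ∑-zero f = refl

    ∑-suc : ∀ n (f : ℕ → C) → ∑ (suc n) f ≈ f 0 + ∑ n (f ∘ suc)
    ∑-suc n f = refl

    ∑-cong : ∀ n {f g : ℕ → C} → (∀ i → i < n → f i ≈ g i) → ∑ n f ≈ ∑ n g
    ∑-cong zero h = refl
    ∑-cong (suc n) h = +-cong (h 0 (s≤s z≤n)) (∑-cong n (λ i i<n → h (suc i) (s≤s i<n)))

    ∑-+ : ∀ n (f g : ℕ → C) → ∑ n (λ i → f i + g i) ≈ ∑ n f + ∑ n g
    ∑-+ zero f g = sym (+-identityʳ 0#)
    ∑-+ (suc n) f g = trans (+-cong refl (∑-+ n (f ∘ suc) (g ∘ suc))) (+-interchange _ _ _ _)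

    ∑-*ˡ : ∀ n c (f : ℕ → C) → c * ∑ n f ≈ ∑ n (λ i → c * f i)
    ∑-*ˡ zero c f = zeroʳ c
    ∑-*ˡ (suc n) c f = trans (distribˡ c (f 0) _) (+-cong refl (∑-*ˡ n c (f ∘ suc)))

    ∑-0 : ∀ n {f : ℕ → C} → (∀ i → i < n → f i ≈ 0#) → ∑ n f ≈ 0#
    ∑-0 zero h = refl
    ∑-0 (suc n) h = trans (+-cong (h 0 (s≤s z≤n)) (∑-0 n (λ i i<n → h (suc i) (s≤s i<n)))) (+-identityʳ 0#)

    ∑-last : ∀ n (f : ℕ → C) → ∑ (suc n) f ≈ ∑ n f + f n
    ∑-last zero f = trans (+-identityʳ _) (sym (+-identityˡ _))
    ∑-last (suc n) f = trans (+-cong refl (∑-last n (f ∘ suc))) (sym (+-assoc _ _ _))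

    ∑-pad : ∀ n k {f : ℕ → C} → (∀ i → n ≤ i → i < n ℕ.+ k → f i ≈ 0#) → ∑ (n ℕ.+ k) f ≈ ∑ n f
    ∑-pad zero k h = ∑-0 k (λ i i< → h i z≤n i<)
    ∑-pad (suc n) k h = +-cong refl (∑-pad n k (λ i n≤i i< → h (suc i) (s≤s n≤i) (s≤s i<)))

    ∑-single : ∀ n k {f : ℕ → C} → k < n → (∀ i → i < n → i ≢ k → f i ≈ 0#) → ∑ n f ≈ f k
    ∑-single (suc n) zero _ h = trans (+-cong refl (∑-0 n (λ i i<n → h (suc i) (s≤s i<n) (λ ())))) (+-identityʳ _)
    ∑-single (suc n) (suc k) (s≤s k<n) h =
      trans (+-cong (h 0 (s≤s z≤n) (λ ())) (∑-single n k k<n (λ i i<n ne → h (suc i) (s≤s i<n) (λ e → ne (NP.suc-injective e)))))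
            (+-identityˡ _)

    ∑-as-sumL : ∀ n (f : ℕ → C) → ∑ n f ≡ sumL (map f (upTo n))
    ∑-as-sumL n f = ≡.cong sumL (≡.sym (LP.map-upTo f n))

  ∑-cong' : ∀ n {f g : ℕ → C} → (∀ i → f i ≈ g i) → ∑ n f ≈ ∑ n g
  ∑-cong' n h = ∑-cong n (λ i _ → h i)

  ∑-*ʳ : ∀ n c (f : ℕ → C) → ∑ n f * c ≈ ∑ n (λ i → f i * c)
  ∑-*ʳ n c f = trans (*-comm _ c) (trans (∑-*ˡ n c f) (∑-cong' n (λ i → *-comm c (f i))))

  ∑-extend : ∀ n n' {f : ℕ → C} → n ≤ n' → (∀ i → n ≤ i → i < n' → f i ≈ 0#) → ∑ n' f ≈ ∑ n f
  ∑-extend n n' le h with NP.m≤n⇒∃[o]m+o≡n le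
  ... | k , ≡.refl = ∑-pad n k h

  ∑-limits : ∀ B1 B2 (f : ℕ → C) → (∀ j → B1 < j → f j ≈ 0#) → (∀ j → B2 < j → f j ≈ 0#) → ∑ (suc B1) f ≈ ∑ (suc B2) f
  ∑-limits B1 B2 f h1 h2 with B1 ℕ.≤? B2
  ... | yes le = sym (∑-extend (suc B1) (suc B2) (s≤s le) (λ j lt _ → h1 j lt))
  ... | no nle = ∑-extend (suc B2) (suc B1) (NP.m≤n⇒m≤1+n (NP.≰⇒> nle)) (λ j lt _ → h2 j lt)

  ∑-swap : ∀ n m (G : ℕ → ℕ → C) → ∑ n (λ i → ∑ m (λ j → G i j)) ≈ ∑ m (λ j → ∑ n (λ i → G i j))
  ∑-swap zero m G = trans (∑-zero _) (sym (∑-0 m (λ j _ → ∑-zero (λ i → G i j))))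
  ∑-swap (suc n) m G = begin
    ∑ (suc n) (λ i → ∑ m (G i))                        ≈⟨ ∑-suc n _ ⟩
    ∑ m (G 0) + ∑ n (λ i → ∑ m (G (suc i)))            ≈⟨ +-cong refl (∑-swap n m (G ∘ suc)) ⟩
    ∑ m (G 0) + ∑ m (λ j → ∑ n (λ i → G (suc i) j))    ≈⟨ sym (∑-+ m (G 0) _) ⟩
    ∑ m (λ j → G 0 j + ∑ n (λ i → G (suc i) j))        ≈⟨ ∑-cong' m (λ j → sym (∑-suc n (λ i → G i j))) ⟩
    ∑ m (λ j → ∑ (suc n) (λ i → G i j))                ∎

  ∑-one : ∀ (f : ℕ → C) → ∑ 1 f ≈ f 0
  ∑-one f = trans (∑-suc 0 f) (trans (+-cong refl (∑-zero _)) (+-identityʳ _))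

  ∑-two : ∀ (f : ℕ → C) → ∑ 2 f ≈ f 0 + f 1
  ∑-two f = trans (∑-suc 1 f) (+-cong refl (∑-one (f ∘ suc)))

  sumL-++ : ∀ xs ys → sumL (xs ++ ys) ≈ sumL xs + sumL ys
  sumL-++ [] ys = sym (+-identityˡ _)
  sumL-++ (x ∷ xs) ys = trans (+-cong refl (sumL-++ xs ys)) (sym (+-assoc _ _ _))

  module _ {b} {A : Set b} where
    sumL-cong : ∀ (xs : List A) {f g : A → C} → (∀ x → f x ≈ g x) → sumL (map f xs) ≈ sumL (map g xs)
    sumL-cong [] h = refl
    sumL-cong (x ∷ xs) h = +-cong (h x) (sumL-cong xs h)

    sumL-*ˡ : ∀ (xs : List A) c (f : A → C) → c * sumL (map f xs) ≈ sumL (map (λ x → c * f x) xs)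
    sumL-*ˡ [] c f = zeroʳ c
    sumL-*ˡ (x ∷ xs) c f = trans (distribˡ c _ _) (+-cong refl (sumL-*ˡ xs c f))

    sumL-*ʳ : ∀ (xs : List A) c (f : A → C) → sumL (map f xs) * c ≈ sumL (map (λ x → f x * c) xs)
    sumL-*ʳ xs c f = trans (*-comm _ c) (trans (sumL-*ˡ xs c f) (sumL-cong xs (λ x → *-comm c (f x))))

    sumL-0 : ∀ (xs : List A) {f : A → C} → (∀ x → f x ≈ 0#) → sumL (map f xs) ≈ 0#
    sumL-0 [] h = refl
    sumL-0 (x ∷ xs) h = trans (+-cong (h x) (sumL-0 xs h)) (+-identityʳ 0#)

    sumL-∑ : ∀ (xs : List A) n (G : A → ℕ → C) →
      sumL (map (λ x → ∑ n (G x)) xs) ≈ ∑ n (λ i → sumL (map (λ x → G x i) xs))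
    sumL-∑ [] n G = sym (∑-0 n (λ _ _ → refl))
    sumL-∑ (x ∷ xs) n G = trans (+-cong refl (sumL-∑ xs n G)) (sym (∑-+ n (G x) _))

    sumL-concatMap : ∀ {c} {B : Set c} (f : A → List B) (g : B → C) (xs : List A) →
      sumL (map g (concatMap f xs)) ≈ sumL (map (λ x → sumL (map g (f x))) xs)
    sumL-concatMap f g [] = refl
    sumL-concatMap f g (x ∷ xs) =
      trans (reflexive (≡.cong sumL (LP.map-++ g (f x) (concatMap f xs))))
            (trans (sumL-++ (map g (f x)) _) (+-cong refl (sumL-concatMap f g xs)))

  _+ᵥ_ : ∀ {k} → Vec ℕ k → Vec ℕ k → Vec ℕ k
  _+ᵥ_ = Vec.zipWith ℕ._+_

  ∣+ᵥ∣ : ∀ {k} (p q : Vec ℕ k) → ∣ p +ᵥ q ∣ ≡ ∣ p ∣ ℕ.+ ∣ q ∣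
  ∣+ᵥ∣ [] [] = ≡.refl
  ∣+ᵥ∣ (x ∷ p) (y ∷ q) rewrite ∣+ᵥ∣ p q = +-interchangeℕ x y ∣ p ∣ ∣ q ∣

  Split : ℕ → Set
  Split k = Vec ℕ k × Vec ℕ k

  conv : ∀ {k} → Coeffs k → Coeffs k → Coeffs k
  conv f g m = sumL (map (λ st → f (proj₁ st) * g (proj₂ st)) (splits m))

  splits-∷ : ∀ {k} e (m : Vec ℕ k) (G : Split (suc k) → C) →
    sumL (map G (splits (e ∷ m))) ≈
    ∑ (suc e) (λ i → sumL (map (λ st → G ((i ∷ proj₁ st) , ((e ∸ i) ∷ proj₂ st))) (splits m)))
  splits-∷ e m G = begin
    sumL (map G (splits (e ∷ m)))
      ≈⟨ sumL-concatMap (λ i → map (extend i) (splits m)) G (upTo (suc e)) ⟩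
    sumL (map (λ i → sumL (map G (map (extend i) (splits m)))) (upTo (suc e)))
      ≡⟨ ≡.cong sumL (LP.map-cong (λ i → ≡.cong sumL (≡.sym (LP.map-∘ (splits m)))) (upTo (suc e))) ⟩
    sumL (map (λ i → sumL (map (G ∘ extend i) (splits m))) (upTo (suc e)))
      ≡⟨ ≡.sym (∑-as-sumL (suc e) _) ⟩
    ∑ (suc e) (λ i → sumL (map (G ∘ extend i) (splits m))) ∎
    where
    extend : ℕ → Split _ → Split (suc _)
    extend i pq = (i ∷ proj₁ pq) , ((e ∸ i) ∷ proj₂ pq)

  conv-∷ : ∀ {k} (f g : Coeffs (suc k)) e m →
    conv f g (e ∷ m) ≈ ∑ (suc e) (λ i → conv (f ∘ (i ∷_)) (g ∘ ((e ∸ i) ∷_)) m)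
  conv-∷ f g e m = splits-∷ e m _

  splits-cong : ∀ {k} (m : Vec ℕ k) {G G' : Split k → C} →
    (∀ p q → p +ᵥ q ≡ m → G (p , q) ≈ G' (p , q)) →
    sumL (map G (splits m)) ≈ sumL (map G' (splits m))
  splits-cong [] h = +-cong (h [] [] ≡.refl) refl
  splits-cong (e ∷ m) {G} {G'} h = begin
    sumL (map G (splits (e ∷ m)))   ≈⟨ splits-∷ e m G ⟩
    ∑ (suc e) (λ i → sumL (map (λ st → G ((i ∷ proj₁ st) , ((e ∸ i) ∷ proj₂ st))) (splits m)))
      ≈⟨ ∑-cong (suc e) (λ i i<e → splits-cong m (λ p q eq →
           h (i ∷ p) ((e ∸ i) ∷ q) (≡.cong₂ _∷_ (NP.m+[n∸m]≡n (NP.≤-pred i<e)) eq))) ⟩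
    ∑ (suc e) (λ i → sumL (map (λ st → G' ((i ∷ proj₁ st) , ((e ∸ i) ∷ proj₂ st))) (splits m)))
      ≈⟨ sym (splits-∷ e m G') ⟩
    sumL (map G' (splits (e ∷ m)))  ∎

  conv-cong : ∀ {k} {f f' g g' : Coeffs k} → f ≐ f' → g ≐ g' → conv f g ≐ conv f' g'
  conv-cong hf hg m = sumL-cong (splits m) (λ st → *-cong (hf _) (hg _))

  conv-*ˡ : ∀ {k} c (f g : Coeffs k) m → conv (λ x → c * f x) g m ≈ c * conv f g m
  conv-*ˡ c f g m = trans (sumL-cong (splits m) (λ st → *-assoc c _ _)) (sym (sumL-*ˡ (splits m) c _))

  conv-*ʳ : ∀ {k} c (f g : Coeffs k) m → conv f (λ x → c * g x) m ≈ c * conv f g m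
  conv-*ʳ c f g m = trans (sumL-cong (splits m) (λ st → *-left-commute _ c _)) (sym (sumL-*ˡ (splits m) c _))

  constP : ∀ {k} → C → Coeffs k
  constP c = coeff (con c)

  varP : ∀ {k} → Fin k → Coeffs k
  varP i = coeff (var i)

  allZero⇒0 : ∀ {k} (m : Vec ℕ k) → allZero m ≡ true → ∣ m ∣ ≡ 0
  allZero⇒0 [] _ = ≡.refl
  allZero⇒0 (zero ∷ m) h = allZero⇒0 m h
  allZero⇒0 (suc e ∷ m) ()

  isUnit⇒1 : ∀ {k} (i : Fin k) (m : Vec ℕ k) → isUnit i m ≡ true → ∣ m ∣ ≡ 1
  isUnit⇒1 zero (1 ∷ m) h = ≡.cong suc (allZero⇒0 m h)
  isUnit⇒1 zero (zero ∷ m) ()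
  isUnit⇒1 zero (suc (suc e) ∷ m) ()
  isUnit⇒1 (suc i) (zero ∷ m) h = isUnit⇒1 i m h
  isUnit⇒1 (suc i) (suc e ∷ m) ()

  constP-0 : ∀ {k} (m : Vec ℕ k) → constP 0# m ≈ 0#
  constP-0 m with allZero m
  ... | true = refl
  ... | false = refl

  constP-* : ∀ {k} c x (m : Vec ℕ k) → constP (c * x) m ≈ c * constP x m
  constP-* c x m with allZero m
  ... | true = refl
  ... | false = sym (zeroʳ c)

  constP-cong : ∀ {k} {x y} → x ≈ y → (m : Vec ℕ k) → constP x m ≈ constP y m
  constP-cong h m with allZero m
  ... | true = h
  ... | false = refl

  conv-const : ∀ {k} c (g : Coeffs k) m → conv (constP c) g m ≈ c * g m
  conv-const c g [] = +-identityʳ _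
  conv-const c g (e ∷ m) = begin
    conv (constP c) g (e ∷ m) ≈⟨ conv-∷ (constP c) g e m ⟩
    ∑ (suc e) (λ i → conv (constP c ∘ (i ∷_)) (g ∘ ((e ∸ i) ∷_)) m) ≈⟨ ∑-suc e _ ⟩
    conv (constP c) (g ∘ (e ∷_)) m + ∑ e (λ i → conv (constP c ∘ (suc i ∷_)) (g ∘ ((e ∸ suc i) ∷_)) m)
      ≈⟨ +-cong (conv-const c (g ∘ (e ∷_)) m) (∑-0 e (λ i _ → sumL-0 (splits m) (λ _ → zeroˡ _))) ⟩
    c * g (e ∷ m) + 0# ≈⟨ +-identityʳ _ ⟩
    c * g (e ∷ m) ∎

  deg-mono : ∀ {k} {f : Coeffs k} {B B'} → B ≤ B' → DegAtMost f B → DegAtMost f B'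
  deg-mono le h m lt = h m (NP.≤-<-trans le lt)

  deg-conv : ∀ {k} {f g : Coeffs k} {B1 B2} → DegAtMost f B1 → DegAtMost g B2 → DegAtMost (conv f g) (B1 ℕ.+ B2)
  deg-conv {f = f} {g} {B1} {B2} hf hg m lt =
    trans (splits-cong m vanishes) (sumL-0 (splits m) (λ _ → refl))
    where
    vanishes : ∀ p q → p +ᵥ q ≡ m → f p * g q ≈ 0#
    vanishes p q eq with B1 ℕ.<? ∣ p ∣ | B2 ℕ.<? ∣ q ∣
    ... | yes b1 | _ = trans (*-cong (hf p b1) refl) (zeroˡ _)
    ... | no _ | yes b2 = trans (*-cong refl (hg q b2)) (zeroʳ _)
    ... | no nb1 | no nb2 = ⊥-elim (NP.<⇒≱ lt (≡.subst (_≤ B1 ℕ.+ B2) (≡.trans (≡.sym (∣+ᵥ∣ p q)) (≡.cong ∣_∣ eq))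
                               (NP.+-mono-≤ (NP.≮⇒≥ nb1) (NP.≮⇒≥ nb2))))

  deg-+ : ∀ {k} {f g : Coeffs k} {B1 B2} → DegAtMost f B1 → DegAtMost g B2 → DegAtMost (λ m → f m + g m) (B1 ℕ.⊔ B2)
  deg-+ {B1 = B1} {B2} hf hg m lt =
    trans (+-cong (hf m (NP.m⊔n<o⇒m<o B1 B2 lt)) (hg m (NP.m⊔n<o⇒n<o B1 B2 lt))) (+-identityʳ 0#)

  deg-coeff : ∀ {k} (e : Expr k) → DegAtMost (coeff e) (degBound e)
  deg-coeff (con c) m lt with allZero m in eq
  ... | true = ⊥-elim (NP.<⇒≢ lt (≡.sym (allZero⇒0 m eq)))
  ... | false = refl
  deg-coeff (var i) m lt with isUnit i m in eq
  ... | true = ⊥-elim (NP.<⇒≢ lt (≡.sym (isUnit⇒1 i m eq)))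
  ... | false = refl
  deg-coeff (p ⊕ q) = deg-+ (deg-coeff p) (deg-coeff q)
  deg-coeff (p ⊗ q) = deg-conv (deg-coeff p) (deg-coeff q)

  ∣∷∣ʰ : ∀ {k} e (m : Vec ℕ k) → e ≤ ∣ e ∷ m ∣
  ∣∷∣ʰ e m = NP.m≤m+n e ∣ m ∣

  ∣∷∣ᵗ : ∀ {k} e (m : Vec ℕ k) → ∣ m ∣ ≤ ∣ e ∷ m ∣
  ∣∷∣ᵗ e m = NP.m≤n+m ∣ m ∣ e

  deg-head : ∀ {k} {f : Coeffs (suc k)} {B} → DegAtMost f B → ∀ e m → B < e → f (e ∷ m) ≈ 0#
  deg-head h e m lt = h (e ∷ m) (NP.<-≤-trans lt (∣∷∣ʰ e m))

  deg-tail : ∀ {k} {f : Coeffs (suc k)} {B} → DegAtMost f B → ∀ i → DegAtMost (λ v → f (i ∷ v)) B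
  deg-tail h i m lt = h (i ∷ m) (NP.<-≤-trans lt (∣∷∣ᵗ i m))

  pow-+ : ∀ x m n → pow x (m ℕ.+ n) ≈ pow x m * pow x n
  pow-+ x zero n = sym (*-identityˡ _)
  pow-+ x (suc m) n = trans (*-cong refl (pow-+ x m n)) (sym (*-assoc _ _ _))

  cauchy : ∀ N (a b : ℕ → C) →
    ∑ N (λ e → ∑ (suc e) (λ i → a i * b (e ∸ i))) ≈ ∑ N (λ i → a i * ∑ (N ∸ i) b)
  cauchy zero a b = trans (∑-zero _) (sym (∑-zero _))
  cauchy (suc N) a b = begin
    ∑ (suc N) (λ e → ∑ (suc e) (λ i → a i * b (e ∸ i)))
      ≈⟨ ∑-last N _ ⟩
    ∑ N (λ e → ∑ (suc e) (λ i → a i * b (e ∸ i))) + ∑ (suc N) (λ i → a i * b (N ∸ i))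
      ≈⟨ +-cong (trans (cauchy N a b) (sym lastTermVanishes)) refl ⟩
    ∑ (suc N) (λ i → a i * ∑ (N ∸ i) b) + ∑ (suc N) (λ i → a i * b (N ∸ i))
      ≈⟨ sym (∑-+ (suc N) (λ i → a i * ∑ (N ∸ i) b) (λ i → a i * b (N ∸ i))) ⟩
    ∑ (suc N) (λ i → a i * ∑ (N ∸ i) b + a i * b (N ∸ i))
      ≈⟨ ∑-cong (suc N) (λ i i<sN → trans (sym (distribˡ (a i) _ _))
            (*-cong refl (trans (sym (∑-last (N ∸ i) b))
               (reflexive (≡.cong (λ z → ∑ z b) (≡.sym (NP.+-∸-assoc 1 (NP.≤-pred i<sN)))))))) ⟩
    ∑ (suc N) (λ i → a i * ∑ (suc N ∸ i) b) ∎
    where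
    lastTermVanishes : ∑ (suc N) (λ i → a i * ∑ (N ∸ i) b) ≈ ∑ N (λ i → a i * ∑ (N ∸ i) b)
    lastTermVanishes = ∑-extend N (suc N) (NP.n≤1+n N) (λ i N≤i _ →
      trans (*-cong refl (trans (reflexive (≡.cong (λ z → ∑ z b) (NP.m≤n⇒m∸n≡0 N≤i))) (∑-zero b))) (zeroʳ (a i)))

  cauchy-finite : ∀ N N1 N2 (a b : ℕ → C) → N1 ≤ N → N1 ℕ.+ N2 ≤ suc N →
    (∀ i → N1 ≤ i → a i ≈ 0#) → (∀ j → N2 ≤ j → b j ≈ 0#) →
    ∑ N (λ e → ∑ (suc e) (λ i → a i * b (e ∸ i))) ≈ ∑ N1 a * ∑ N2 b
  cauchy-finite N N1 N2 a b le1 le2 ha hb = begin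
    ∑ N (λ e → ∑ (suc e) (λ i → a i * b (e ∸ i))) ≈⟨ cauchy N a b ⟩
    ∑ N (λ i → a i * ∑ (N ∸ i) b)   ≈⟨ ∑-extend N1 N le1 (λ i n1≤i _ → trans (*-cong (ha i n1≤i) refl) (zeroˡ _)) ⟩
    ∑ N1 (λ i → a i * ∑ (N ∸ i) b)  ≈⟨ ∑-cong N1 (λ i i<N1 → *-cong refl (∑-extend N2 (N ∸ i) (room i i<N1) (λ j n2≤j _ → hb j n2≤j))) ⟩
    ∑ N1 (λ i → a i * ∑ N2 b)       ≈⟨ sym (∑-*ʳ N1 _ a) ⟩
    ∑ N1 a * ∑ N2 b                 ∎
    where
    room : ∀ i → i < N1 → N2 ≤ N ∸ i
    room i i<N1 = ≡.subst (_≤ N ∸ i) (NP.m+n∸m≡n i N2)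
      (NP.∸-monoˡ-≤ i (NP.≤-pred (NP.≤-trans (NP.+-monoˡ-≤ N2 i<N1) le2)))

  -- the coefficients of f(β, x), provided the first exponent of f is at most B
  evalHead : ∀ {k} → C → ℕ → Coeffs (suc k) → Coeffs k
  evalHead β B f m = ∑ (suc B) (λ e → f (e ∷ m) * pow β e)

  evalHead-limits : ∀ {k} β {f : Coeffs (suc k)} B1 B2 → DegAtMost f B1 → DegAtMost f B2 →
    ∀ m → evalHead β B1 f m ≈ evalHead β B2 f m
  evalHead-limits β B1 B2 h1 h2 m = ∑-limits B1 B2 _
    (λ e lt → trans (*-cong (deg-head h1 e m lt) refl) (zeroˡ _))
    (λ e lt → trans (*-cong (deg-head h2 e m lt) refl) (zeroˡ _))

  evalHead-bound : ∀ {k} β {f : Coeffs (suc k)} {B0} B → DegAtMost f B0 → B0 ≤ B → ∀ m → evalHead β B f m ≈ evalHead β B0 f m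
  evalHead-bound β B h le = evalHead-limits β B _ (deg-mono le h) h

  evalHead-cong : ∀ {k} β B {f g : Coeffs (suc k)} → f ≐ g → evalHead β B f ≐ evalHead β B g
  evalHead-cong β B h m = ∑-cong' (suc B) (λ e → *-cong (h (e ∷ m)) refl)

  evalHead-+ : ∀ {k} β B (f g : Coeffs (suc k)) m → evalHead β B (λ v → f v + g v) m ≈ evalHead β B f m + evalHead β B g m
  evalHead-+ β B f g m = trans (∑-cong' (suc B) (λ e → distribʳ _ _ _)) (∑-+ (suc B) _ _)

  evalHead-mult : ∀ {k} β {f g : Coeffs (suc k)} {B1 B2} → DegAtMost f B1 → DegAtMost g B2 →
    ∀ m → evalHead β (B1 ℕ.+ B2) (conv f g) m ≈ conv (evalHead β B1 f) (evalHead β B2 g) m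
  evalHead-mult β {f} {g} {B1} {B2} hf hg m = begin
    ∑ N (λ e → conv f g (e ∷ m) * pow β e)
      ≈⟨ ∑-cong' N (λ e → trans (*-cong (conv-∷ f g e m) refl) (∑-*ʳ (suc e) (pow β e) _)) ⟩
    ∑ N (λ e → ∑ (suc e) (λ i → conv (f ∘ (i ∷_)) (g ∘ ((e ∸ i) ∷_)) m * pow β e))
      ≈⟨ ∑-cong N (λ e _ → ∑-cong (suc e) (λ i i<se →
           trans (sumL-*ʳ (splits m) (pow β e) _) (sumL-cong (splits m) (λ st → regroup e i st (NP.≤-pred i<se))))) ⟩
    ∑ N (λ e → ∑ (suc e) (λ i → sumL (map (λ st → fAt (proj₁ st) i * gAt (proj₂ st) (e ∸ i)) (splits m))))
      ≈⟨ ∑-cong' N (λ e → sym (sumL-∑ (splits m) (suc e) (λ st i → fAt (proj₁ st) i * gAt (proj₂ st) (e ∸ i)))) ⟩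
    ∑ N (λ e → sumL (map (λ st → ∑ (suc e) (λ i → fAt (proj₁ st) i * gAt (proj₂ st) (e ∸ i))) (splits m)))
      ≈⟨ sym (sumL-∑ (splits m) N (λ st e → ∑ (suc e) (λ i → fAt (proj₁ st) i * gAt (proj₂ st) (e ∸ i)))) ⟩
    sumL (map (λ st → ∑ N (λ e → ∑ (suc e) (λ i → fAt (proj₁ st) i * gAt (proj₂ st) (e ∸ i)))) (splits m))
      ≈⟨ sumL-cong (splits m) (λ st → cauchy-finite N (suc B1) (suc B2) (fAt (proj₁ st)) (gAt (proj₂ st))
             (s≤s (NP.m≤m+n B1 B2)) (s≤s (NP.≤-reflexive (NP.+-suc B1 B2)))
             (λ i le → trans (*-cong (deg-head hf i (proj₁ st) le) refl) (zeroˡ _))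
             (λ j le → trans (*-cong (deg-head hg j (proj₂ st) le) refl) (zeroˡ _))) ⟩
    conv (evalHead β B1 f) (evalHead β B2 g) m ∎
    where
    N : ℕ
    N = suc (B1 ℕ.+ B2)
    fAt : Vec ℕ _ → ℕ → C
    fAt p i = f (i ∷ p) * pow β i
    gAt : Vec ℕ _ → ℕ → C
    gAt q j = g (j ∷ q) * pow β j
    regroup : ∀ e i st → i ≤ e →
      f (i ∷ proj₁ st) * g ((e ∸ i) ∷ proj₂ st) * pow β e ≈ fAt (proj₁ st) i * gAt (proj₂ st) (e ∸ i)
    regroup e i st le = begin
      f (i ∷ proj₁ st) * g ((e ∸ i) ∷ proj₂ st) * pow β e
        ≈⟨ *-cong refl (reflexive (≡.cong (pow β) (≡.sym (NP.m+[n∸m]≡n le)))) ⟩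
      f (i ∷ proj₁ st) * g ((e ∸ i) ∷ proj₂ st) * pow β (i ℕ.+ (e ∸ i))
        ≈⟨ *-cong refl (pow-+ β i (e ∸ i)) ⟩
      f (i ∷ proj₁ st) * g ((e ∸ i) ∷ proj₂ st) * (pow β i * pow β (e ∸ i))
        ≈⟨ *-interchange _ _ _ _ ⟩
      fAt (proj₁ st) i * gAt (proj₂ st) (e ∸ i) ∎

  evalSecond : ∀ {k} → C → ℕ → Coeffs (suc (suc k)) → Coeffs (suc k)
  evalSecond α B f (j ∷ m) = evalHead α B (λ v → f (j ∷ v)) m

  deg-evalSecond : ∀ {k} α B {f : Coeffs (suc (suc k))} {B0} → DegAtMost f B0 → DegAtMost (evalSecond α B f) B0
  deg-evalSecond α B h (j ∷ m) lt =
    ∑-0 (suc B) (λ e _ → trans (*-cong (h (j ∷ e ∷ m) (NP.<-≤-trans lt (NP.+-monoʳ-≤ j (∣∷∣ᵗ e m)))) refl) (zeroˡ _))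

  evalSecond-bound : ∀ {k} α {f : Coeffs (suc (suc k))} {B0} B → DegAtMost f B0 → B0 ≤ B → evalSecond α B f ≐ evalSecond α B0 f
  evalSecond-bound α B h le (j ∷ m) = evalHead-bound α B (deg-tail h j) le m

  evalSecond-+ : ∀ {k} α B (f g : Coeffs (suc (suc k))) m → evalSecond α B (λ v → f v + g v) m ≈ evalSecond α B f m + evalSecond α B g m
  evalSecond-+ α B f g (j ∷ m) = evalHead-+ α B (λ v → f (j ∷ v)) (λ v → g (j ∷ v)) m

  evalSecond-mult : ∀ {k} α {f g : Coeffs (suc (suc k))} {B1 B2} → DegAtMost f B1 → DegAtMost g B2 →
    ∀ m → evalSecond α (B1 ℕ.+ B2) (conv f g) m ≈ conv (evalSecond α B1 f) (evalSecond α B2 g) m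
  evalSecond-mult α {f} {g} {B1} {B2} hf hg (j ∷ m) = begin
    ∑ N (λ e → conv f g (j ∷ e ∷ m) * pow α e)
      ≈⟨ ∑-cong' N (λ e → trans (*-cong (conv-∷ f g j (e ∷ m)) refl) (∑-*ʳ (suc j) (pow α e) _)) ⟩
    ∑ N (λ e → ∑ (suc j) (λ i → conv (f ∘ (i ∷_)) (g ∘ ((j ∸ i) ∷_)) (e ∷ m) * pow α e))
      ≈⟨ ∑-swap N (suc j) (λ e i → conv (f ∘ (i ∷_)) (g ∘ ((j ∸ i) ∷_)) (e ∷ m) * pow α e) ⟩
    ∑ (suc j) (λ i → evalHead α (B1 ℕ.+ B2) (conv (f ∘ (i ∷_)) (g ∘ ((j ∸ i) ∷_))) m)
      ≈⟨ ∑-cong' (suc j) (λ i → evalHead-mult α (deg-tail hf i) (deg-tail hg (j ∸ i)) m) ⟩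
    ∑ (suc j) (λ i → conv (evalHead α B1 (f ∘ (i ∷_))) (evalHead α B2 (g ∘ ((j ∸ i) ∷_))) m)
      ≈⟨ sym (conv-∷ (evalSecond α B1 f) (evalSecond α B2 g) j m) ⟩
    conv (evalSecond α B1 f) (evalSecond α B2 g) (j ∷ m) ∎
    where
    N : ℕ
    N = suc (B1 ℕ.+ B2)

  -- Dilation f ↦ f(τ x): the coefficient at m is scaled by τ^|m|; it is multiplicative.
  dilate : ∀ {k} → C → Coeffs k → Coeffs k
  dilate τ f m = pow τ ∣ m ∣ * f m

  dilate-cong : ∀ {k} τ {f g : Coeffs k} → f ≐ g → dilate τ f ≐ dilate τ g
  dilate-cong τ h m = *-cong refl (h m)

  dilate-mult : ∀ {k} τ (f g : Coeffs k) m → dilate τ (conv f g) m ≈ conv (dilate τ f) (dilate τ g) m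
  dilate-mult τ f g m = trans (sumL-*ˡ (splits m) (pow τ ∣ m ∣) _) (splits-cong m λ p q eq → begin
    pow τ ∣ m ∣ * (f p * g q)                  ≈⟨ *-cong (reflexive (≡.cong (pow τ) (≡.trans (≡.cong ∣_∣ (≡.sym eq)) (∣+ᵥ∣ p q)))) refl ⟩
    pow τ (∣ p ∣ ℕ.+ ∣ q ∣) * (f p * g q)      ≈⟨ *-cong (pow-+ τ ∣ p ∣ ∣ q ∣) refl ⟩
    (pow τ ∣ p ∣ * pow τ ∣ q ∣) * (f p * g q)  ≈⟨ *-interchange _ _ _ _ ⟩
    (pow τ ∣ p ∣ * f p) * (pow τ ∣ q ∣ * g q)  ∎)

  dilate-const : ∀ {k} τ x (m : Vec ℕ k) → pow τ ∣ m ∣ * constP x m ≈ constP x m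
  dilate-const τ x m with allZero m in eq
  ... | true = trans (*-cong (reflexive (≡.cong (pow τ) (allZero⇒0 m eq))) refl) (*-identityˡ x)
  ... | false = zeroʳ _

  -- The substitution y := α, z := β in
  -- P(x, y + z) (variables ordered z, y, x) yields P(x, α + β); its coefficients of z^j
  -- before substituting z are the Hasse derivatives ∂ʲP(x, α), so
  --   Σ_j ∂ʲP(x, α) β^j = P(x, α + β).
  degBound-shiftY : ∀ {n} (P : Expr (suc n)) → degBound (shiftY P) ≡ degBound P
  degBound-shiftY (con c) = ≡.refl
  degBound-shiftY (var zero) = ≡.refl
  degBound-shiftY (var (suc i)) = ≡.refl
  degBound-shiftY (p ⊕ q) = ≡.cong₂ ℕ._⊔_ (degBound-shiftY p) (degBound-shiftY q)
  degBound-shiftY (p ⊗ q) = ≡.cong₂ ℕ._+_ (degBound-shiftY p) (degBound-shiftY q)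

  deg-shiftY : ∀ {n} (P : Expr (suc n)) → DegAtMost (coeff (shiftY P)) (degBound P)
  deg-shiftY P = ≡.subst (DegAtMost (coeff (shiftY P))) (degBound-shiftY P) (deg-coeff (shiftY P))

  evalYZ : ∀ {n} → C → C → ℕ → Coeffs (suc (suc n)) → Coeffs n
  evalYZ α β B f = evalHead β B (evalSecond α B f)

  evalYZ-bound : ∀ {n} α β {f : Coeffs (suc (suc n))} {B0} B → DegAtMost f B0 → B0 ≤ B → evalYZ α β B f ≐ evalYZ α β B0 f
  evalYZ-bound α β B h le m =
    trans (evalHead-cong β B (evalSecond-bound α B h le) m) (evalHead-bound β B (deg-evalSecond α _ h) le m)

  shift-con : ∀ {n} α β c (m : Vec ℕ n) → evalYZ α β 0 (coeff (shiftY {n} (con c))) m ≈ evalHead (α + β) 0 (coeff (con c)) m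
  shift-con α β c m = begin
    ∑ 1 (λ j → ∑ 1 (λ e → coeff (con c) (j ∷ e ∷ m) * pow α e) * pow β j)
      ≈⟨ ∑-one _ ⟩
    ∑ 1 (λ e → coeff (con c) (0 ∷ e ∷ m) * pow α e) * 1#
      ≈⟨ *-cong (∑-one _) refl ⟩
    (if allZero m then c else 0#) * 1# * 1#
      ≈⟨ *-identityʳ _ ⟩
    (if allZero m then c else 0#) * 1#
      ≈⟨ sym (∑-one _) ⟩
    ∑ 1 (λ e → coeff (con c) (e ∷ m) * pow (α + β) e) ∎

  shift-y : ∀ {n} α β (m : Vec ℕ n) → evalYZ α β 1 (coeff (shiftY {n} (var zero))) m ≈ evalHead (α + β) 1 (coeff (var zero)) m
  shift-y α β m = begin
    ∑ 2 (λ j → ∑ 2 (λ e → (coeff (var (suc zero)) (j ∷ e ∷ m) + coeff (var zero) (j ∷ e ∷ m)) * pow α e) * pow β j)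
      ≈⟨ ∑-two _ ⟩
    ∑ 2 (λ e → (coeff (var (suc zero)) (0 ∷ e ∷ m) + coeff (var zero) (0 ∷ e ∷ m)) * pow α e) * pow β 0
    + ∑ 2 (λ e → (coeff (var (suc zero)) (1 ∷ e ∷ m) + coeff (var zero) (1 ∷ e ∷ m)) * pow α e) * pow β 1
      ≈⟨ +-cong (*-cong (∑-two _) refl) (*-cong (∑-two _) refl) ⟩
    ((0# + 0#) * 1# + ((if allZero m then 1# else 0#) + 0#) * (α * 1#)) * 1#
    + ((0# + (if allZero m then 1# else 0#)) * 1# + (0# + 0#) * (α * 1#)) * (β * 1#)
      ≈⟨ collect (allZero m) ⟩
    0# * 1# + (if allZero m then 1# else 0#) * ((α + β) * 1#)
      ≈⟨ sym (∑-two _) ⟩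
    ∑ 2 (λ e → coeff (var zero) (e ∷ m) * pow (α + β) e) ∎
    where
    -- only the monomials y (value α) and z (value β) of y + z survive
    collect : ∀ b → ((0# + 0#) * 1# + ((if b then 1# else 0#) + 0#) * (α * 1#)) * 1#
        + ((0# + (if b then 1# else 0#)) * 1# + (0# + 0#) * (α * 1#)) * (β * 1#)
        ≈ 0# * 1# + (if b then 1# else 0#) * ((α + β) * 1#)
    collect b = solve 3 (λ x α β → ((con 0 :+ con 0) :* con 1 :+ (x :+ con 0) :* (α :* con 1)) :* con 1
        :+ ((con 0 :+ x) :* con 1 :+ (con 0 :+ con 0) :* (α :* con 1)) :* (β :* con 1)
        := con 0 :* con 1 :+ x :* ((α :+ β) :* con 1)) refl (if b then 1# else 0#) α β

  shift-x : ∀ {n} α β (i : Fin n) m → evalYZ α β 1 (coeff (shiftY (var (suc i)))) m ≈ evalHead (α + β) 1 (coeff (var (suc i))) m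
  shift-x α β i m = begin
    ∑ 2 (λ j → ∑ 2 (λ e → coeff (var (suc (suc i))) (j ∷ e ∷ m) * pow α e) * pow β j)
      ≈⟨ ∑-two _ ⟩
    ∑ 2 (λ e → coeff (var (suc (suc i))) (0 ∷ e ∷ m) * pow α e) * pow β 0
    + ∑ 2 (λ e → coeff (var (suc (suc i))) (1 ∷ e ∷ m) * pow α e) * pow β 1
      ≈⟨ +-cong (*-cong (∑-two _) refl) (*-cong (∑-two _) refl) ⟩
    ((if isUnit i m then 1# else 0#) * 1# + 0# * (α * 1#)) * 1#
    + (0# * 1# + 0# * (α * 1#)) * (β * 1#)
      ≈⟨ solve 3 (λ x α β → (x :* con 1 :+ con 0 :* (α :* con 1)) :* con 1
        :+ (con 0 :* con 1 :+ con 0 :* (α :* con 1)) :* (β :* con 1)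
        := x :* con 1 :+ con 0 :* ((α :+ β) :* con 1)) refl (if isUnit i m then 1# else 0#) α β ⟩
    (if isUnit i m then 1# else 0#) * 1# + 0# * ((α + β) * 1#)
      ≈⟨ sym (∑-two _) ⟩
    ∑ 2 (λ e → coeff (var (suc i)) (e ∷ m) * pow (α + β) e) ∎

  evalYZ-shiftY : ∀ {n} α β (P : Expr (suc n)) → evalYZ α β (degBound P) (coeff (shiftY P)) ≐ evalHead (α + β) (degBound P) (coeff P)
  evalYZ-shiftY α β (con c) = shift-con α β c
  evalYZ-shiftY α β (var zero) = shift-y α β
  evalYZ-shiftY α β (var (suc i)) = shift-x α β i
  evalYZ-shiftY α β (p ⊕ q) m = begin
    evalYZ α β B (λ v → coeff (shiftY p) v + coeff (shiftY q) v) m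
      ≈⟨ evalHead-cong β B (evalSecond-+ α B (coeff (shiftY p)) (coeff (shiftY q))) m ⟩
    evalHead β B (λ v → evalSecond α B (coeff (shiftY p)) v + evalSecond α B (coeff (shiftY q)) v) m
      ≈⟨ evalHead-+ β B (evalSecond α B (coeff (shiftY p))) (evalSecond α B (coeff (shiftY q))) m ⟩
    evalYZ α β B (coeff (shiftY p)) m + evalYZ α β B (coeff (shiftY q)) m
      ≈⟨ +-cong (evalYZ-bound α β B (deg-shiftY p) (NP.m≤m⊔n _ _) m) (evalYZ-bound α β B (deg-shiftY q) (NP.m≤n⊔m _ _) m) ⟩
    evalYZ α β (degBound p) (coeff (shiftY p)) m + evalYZ α β (degBound q) (coeff (shiftY q)) m
      ≈⟨ +-cong (evalYZ-shiftY α β p m) (evalYZ-shiftY α β q m) ⟩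
    evalHead (α + β) (degBound p) (coeff p) m + evalHead (α + β) (degBound q) (coeff q) m
      ≈⟨ sym (+-cong (evalHead-bound (α + β) B (deg-coeff p) (NP.m≤m⊔n _ _) m) (evalHead-bound (α + β) B (deg-coeff q) (NP.m≤n⊔m _ _) m)) ⟩
    evalHead (α + β) B (coeff p) m + evalHead (α + β) B (coeff q) m
      ≈⟨ sym (evalHead-+ (α + β) B (coeff p) (coeff q) m) ⟩
    evalHead (α + β) B (coeff (p ⊕ q)) m ∎
    where
    B : ℕ
    B = degBound p ℕ.⊔ degBound q
  evalYZ-shiftY α β (p ⊗ q) m = begin
    evalHead β B (evalSecond α B (conv (coeff (shiftY p)) (coeff (shiftY q)))) m
      ≈⟨ evalHead-cong β B (evalSecond-mult α (deg-shiftY p) (deg-shiftY q)) m ⟩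
    evalHead β B (conv (evalSecond α Bp (coeff (shiftY p))) (evalSecond α Bq (coeff (shiftY q)))) m
      ≈⟨ evalHead-mult β (deg-evalSecond α Bp (deg-shiftY p)) (deg-evalSecond α Bq (deg-shiftY q)) m ⟩
    conv (evalYZ α β Bp (coeff (shiftY p))) (evalYZ α β Bq (coeff (shiftY q))) m
      ≈⟨ conv-cong (evalYZ-shiftY α β p) (evalYZ-shiftY α β q) m ⟩
    conv (evalHead (α + β) Bp (coeff p)) (evalHead (α + β) Bq (coeff q)) m
      ≈⟨ sym (evalHead-mult (α + β) (deg-coeff p) (deg-coeff q) m) ⟩
    evalHead (α + β) B (coeff (p ⊗ q)) m ∎
    where
    Bp : ℕ
    Bp = degBound p
    Bq : ℕ
    Bq = degBound q
    B : ℕ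
    B = Bp ℕ.+ Bq

  hasseAt-evalSecond : ∀ {n} j (P : Expr (suc n)) α m → hasseAt j P α m ≡ evalSecond α (degBound P) (coeff (shiftY P)) (j ∷ m)
  hasseAt-evalSecond j P α m = ≡.sym (∑-as-sumL (suc (degBound P)) _)

  taylor : ∀ {n} (P : Expr (suc n)) α β m →
    ∑ (suc (degBound P)) (λ j → hasseAt j P α m * pow β j) ≈ evalHead (α + β) (degBound P) (coeff P) m
  taylor P α β m = trans (∑-cong' (suc (degBound P)) (λ j → reflexive (≡.cong (_* pow β j) (hasseAt-evalSecond j P α m))))
    (evalYZ-shiftY α β P m)

  y+[x-y]≈x : ∀ x y → y + (x - y) ≈ x
  y+[x-y]≈x x y = trans (sym (+-assoc y x (- y))) (xyx⁻¹≈y y x)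

  embℕ-+ : ∀ m n → embℕ (m ℕ.+ n) ≈ embℕ m + embℕ n
  embℕ-+ zero n = sym (+-identityˡ _)
  embℕ-+ (suc m) n = trans (+-cong refl (embℕ-+ m n)) (sym (+-assoc _ _ _))

  embℕ-< : CharZero → ∀ m n → m < n → ¬ (embℕ m ≈ embℕ n)
  embℕ-< cz m n lt h with NP.m≤n⇒∃[o]m+o≡n lt
  ... | k , ≡.refl = cz k (+-identityʳ-unique (embℕ m) _ (trans (sym split) (sym h)))
    where
    split : embℕ (suc m ℕ.+ k) ≈ embℕ m + embℕ (suc k)
    split = trans (reflexive (≡.cong embℕ (≡.sym (NP.+-suc m k)))) (embℕ-+ m (suc k))

  embℕ-injective : CharZero → ∀ m n → m ≢ n → ¬ (embℕ m ≈ embℕ n)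
  embℕ-injective cz m n ne h with NP.<-cmp m n
  ... | tri< lt _ _ = embℕ-< cz m n lt h
  ... | tri≈ _ eq _ = ne eq
  ... | tri> _ _ gt = embℕ-< cz n m gt (sym h)

  δ : ℕ → ℕ → C
  δ k j = if j ℕ.≡ᵇ k then 1# else 0#

  δ-self : ∀ k → δ k k ≈ 1#
  δ-self k with k ℕ.≡ᵇ k in eq
  ... | true = refl
  ... | false = ⊥-elim (≡.subst T eq (NP.≡⇒≡ᵇ k k ≡.refl))

  δ-ne : ∀ k j → j ≢ k → δ k j ≈ 0#
  δ-ne k j ne with j ℕ.≡ᵇ k in eq
  ... | true = ⊥-elim (ne (NP.≡ᵇ⇒≡ j k (≡.subst T (≡.sym eq) _)))
  ... | false = refl

  ∑-δ : ∀ N k (c : ℕ → C) → k ≤ N → ∑ (suc N) (λ j → c j * δ k j) ≈ c k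
  ∑-δ N k c le = trans (∑-single (suc N) k (s≤s le) (λ j _ ne → trans (*-cong refl (δ-ne k j ne)) (zeroʳ _)))
    (trans (*-cong refl (δ-self k)) (*-identityʳ _))

  Distinct : ℕ → (ℕ → C) → Set ℓ
  Distinct N p = ∀ a b → a ≤ N → b ≤ N → a ≢ b → ¬ (p a ≈ p b)

  moment : ℕ → (ℕ → C) → (ℕ → C) → ℕ → C
  moment N p ν j = ∑ (suc N) (λ a → ν a * pow (p a) j)

  moment-suc : ∀ N p ν q j → moment N p ν (suc j) ≈ q * moment N p ν j + moment N p (λ a → ν a * (p a - q)) j
  moment-suc N p ν q j = begin
    moment N p ν (suc j)
      ≈⟨ ∑-cong' (suc N) term ⟩
    ∑ (suc N) (λ a → q * (ν a * pow (p a) j) + ν a * (p a - q) * pow (p a) j)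
      ≈⟨ trans (∑-+ (suc N) _ _) (+-cong (sym (∑-*ˡ (suc N) q _)) refl) ⟩
    q * moment N p ν j + moment N p (λ a → ν a * (p a - q)) j ∎
    where
    term : ∀ a → ν a * (p a * pow (p a) j) ≈ q * (ν a * pow (p a) j) + ν a * (p a - q) * pow (p a) j
    term a = trans (*-cong refl (*-cong (sym (y+[x-y]≈x (p a) q)) refl))
      (solve 4 (λ c q d X → c :* ((q :+ d) :* X) := q :* (c :* X) :+ (c :* d) :* X) refl (ν a) q (p a - q) (pow (p a) j))

  inverses : ∀ N (x : ℕ → C) → (∀ a → a ≤ N → ¬ (x a ≈ 0#)) → Σ (ℕ → C) λ y → ∀ a → a ≤ N → x a * y a ≈ 1#
  inverses N x nz = (λ a → choose a (a ℕ.≤? N)) , isInverse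
    where
    choose : ∀ a → Dec (a ≤ N) → C
    choose a (yes le) = proj₁ (inverse (x a) (nz a le))
    choose a (no _) = 0#
    isInverse : ∀ a → a ≤ N → x a * choose a (a ℕ.≤? N) ≈ 1#
    isInverse a le with a ℕ.≤? N
    ... | yes le' = proj₂ (inverse (x a) (nz a le'))
    ... | no nle = ⊥-elim (nle le)

  moment-drop-last : ∀ N p (f g : ℕ → C) → (∀ a → a < suc N → f a ≈ g a) → f (suc N) ≈ 0# →
    ∀ j → moment (suc N) p f j ≈ moment N p g j
  moment-drop-last N p f g low last0 j = begin
    moment (suc N) p f j                        ≈⟨ ∑-last (suc N) _ ⟩
    ∑ (suc N) (λ a → f a * pow (p a) j) + f (suc N) * pow (p (suc N)) j
      ≈⟨ +-cong (∑-cong (suc N) (λ a lt → *-cong (low a lt) refl)) (trans (*-cong last0 refl) (zeroˡ _)) ⟩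
    moment N p g j + 0#                         ≈⟨ +-identityʳ _ ⟩
    moment N p g j                              ∎

  extendWeights : ℕ → (ℕ → C) → C → ℕ → C
  extendWeights N ν last a with a ℕ.≟ suc N
  ... | yes _ = last
  ... | no _ = ν a

  extendWeights-low : ∀ N ν last a → a < suc N → extendWeights N ν last a ≈ ν a
  extendWeights-low N ν last a lt with a ℕ.≟ suc N
  ... | yes e = ⊥-elim (NP.<⇒≢ lt e)
  ... | no _ = refl

  extendWeights-last : ∀ N ν last → extendWeights N ν last (suc N) ≈ last
  extendWeights-last N ν last with suc N ℕ.≟ suc N
  ... | yes _ = refl
  ... | no ne = ⊥-elim (ne ≡.refl)

  -- Induction on N: solve the system at p 0, …, p N for u j = w (j+1) − q w j, where
  -- q = p (N+1), divide the weights by p a − q, and let the last weight fix the 0th moment.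
  vandermonde : ∀ N (p : ℕ → C) → Distinct N p → ∀ (w : ℕ → C) → ∃ λ ν → ∀ j → j ≤ N → moment N p ν j ≈ w j
  vandermonde zero p _ w = (λ _ → w 0) , λ { zero _ → trans (∑-one _) (*-identityʳ _) }
  vandermonde (suc N) p distinct w = ν , solves
    where
    q : C
    q = p (suc N)
    u : ℕ → C
    u j = w (suc j) - q * w j
    smaller : ∃ λ ν' → ∀ j → j ≤ N → moment N p ν' j ≈ u j
    smaller = vandermonde N p (λ a b a≤ b≤ → distinct a b (NP.m≤n⇒m≤1+n a≤) (NP.m≤n⇒m≤1+n b≤)) u
    gaps : Σ (ℕ → C) λ y → ∀ a → a ≤ N → (p a - q) * y a ≈ 1#
    gaps = inverses N (λ a → p a - q) (λ a le h →
      distinct a (suc N) (NP.m≤n⇒m≤1+n le) NP.≤-refl (NP.<⇒≢ (s≤s le)) (x∙y⁻¹≈ε⇒x≈y _ _ h))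
    ν₀ : ℕ → C
    ν₀ a = proj₁ smaller a * proj₁ gaps a
    ν₀-gap : ∀ a → a ≤ N → ν₀ a * (p a - q) ≈ proj₁ smaller a
    ν₀-gap a le = trans (*-assoc _ _ _) (trans (*-cong refl (trans (*-comm _ _) (proj₂ gaps a le))) (*-identityʳ _))
    ν : ℕ → C
    ν = extendWeights N ν₀ (w 0 - ∑ (suc N) ν₀)
    solves : ∀ j → j ≤ suc N → moment (suc N) p ν j ≈ w j
    solves zero _ = begin
      moment (suc N) p ν 0                       ≈⟨ ∑-last (suc N) _ ⟩
      ∑ (suc N) (λ a → ν a * 1#) + ν (suc N) * 1#
        ≈⟨ +-cong (∑-cong (suc N) (λ a lt → trans (*-identityʳ _) (extendWeights-low N ν₀ _ a lt)))
                  (trans (*-identityʳ _) (extendWeights-last N ν₀ _)) ⟩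
      ∑ (suc N) ν₀ + (w 0 - ∑ (suc N) ν₀)        ≈⟨ y+[x-y]≈x (w 0) _ ⟩
      w 0                                        ∎
    solves (suc j) (s≤s le) = begin
      moment (suc N) p ν (suc j)
        ≈⟨ moment-suc (suc N) p ν q j ⟩
      q * moment (suc N) p ν j + moment (suc N) p (λ a → ν a * (p a - q)) j
        ≈⟨ +-cong (*-cong refl (solves j (NP.m≤n⇒m≤1+n le)))
                  (trans (moment-drop-last N p _ (proj₁ smaller)
                           (λ a lt → trans (*-cong (extendWeights-low N ν₀ _ a lt) refl) (ν₀-gap a (NP.≤-pred lt)))
                           (trans (*-cong refl (-‿inverseʳ q)) (zeroʳ _)) j)
                         (proj₂ smaller j le)) ⟩
      q * w j + (w (suc j) - q * w j)
        ≈⟨ y+[x-y]≈x _ _ ⟩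
      w (suc j) ∎

  extract : ∀ N (p : ℕ → C) → Distinct N p → ∀ k → k ≤ N → Σ (ℕ → C) λ ν → ∀ (c : ℕ → C) →
    c k ≈ ∑ (suc N) (λ b → ν b * ∑ (suc N) (λ j → c j * pow (p b) j))
  extract N p distinct k le = ν , λ c → begin
    c k                                                            ≈⟨ sym (∑-δ N k c le) ⟩
    ∑ (suc N) (λ j → c j * δ k j)                                  ≈⟨ ∑-cong (suc N) (λ j lt → *-cong refl (sym (proj₂ V j (NP.≤-pred lt)))) ⟩
    ∑ (suc N) (λ j → c j * ∑ (suc N) (λ b → ν b * pow (p b) j))    ≈⟨ ∑-cong' (suc N) (λ j → ∑-*ˡ (suc N) (c j) _) ⟩
    ∑ (suc N) (λ j → ∑ (suc N) (λ b → c j * (ν b * pow (p b) j)))  ≈⟨ ∑-swap (suc N) (suc N) _ ⟩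
    ∑ (suc N) (λ b → ∑ (suc N) (λ j → c j * (ν b * pow (p b) j)))  ≈⟨ ∑-cong' (suc N) (λ b → trans (∑-cong' (suc N) (λ j → *-left-commute (c j) (ν b) _)) (sym (∑-*ˡ (suc N) (ν b) _))) ⟩
    ∑ (suc N) (λ b → ν b * ∑ (suc N) (λ j → c j * pow (p b) j))    ∎
    where
    V : ∃ λ ν → ∀ j → j ≤ N → moment N p ν j ≈ δ k j
    V = vandermonde N p distinct (δ k)
    ν : ℕ → C
    ν = proj₁ V

  poly-identity : ∀ N (p : ℕ → C) → Distinct N p → (c c' : ℕ → C) →
    (∀ b → b ≤ N → ∑ (suc N) (λ j → c j * pow (p b) j) ≈ ∑ (suc N) (λ j → c' j * pow (p b) j)) → ∀ k → k ≤ N → c k ≈ c' k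
  poly-identity N p distinct c c' h k le =
    trans (proj₂ E c) (trans (∑-cong (suc N) (λ b lt → *-cong refl (h b (NP.≤-pred lt)))) (sym (proj₂ E c')))
    where
    E : Σ (ℕ → C) λ ν → ∀ (c : ℕ → C) → c k ≈ ∑ (suc N) (λ b → ν b * ∑ (suc N) (λ j → c j * pow (p b) j))
    E = extract N p distinct k le

  Binomial : C → ℕ → Set (a ⊔ ℓ)
  Binomial α e = Σ (ℕ → C) λ c → (∀ j → e < j → c j ≈ 0#) × (∀ β → pow (α + β) e ≈ ∑ (suc e) (λ j → c j * pow β j))

  -- multiplying a polynomial in β by β shifts its coefficient sequence
  shiftSeq : (ℕ → C) → ℕ → C
  shiftSeq c zero = 0#
  shiftSeq c (suc j) = c j

  binomial : ∀ α e → Binomial α e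
  binomial α zero = δ 0 , (λ { (suc j) _ → refl }) , λ β → sym (trans (∑-one _) (trans (*-identityʳ _) (δ-self 0)))
  binomial α (suc e) = c' , vanishes , expands
    where
    c : ℕ → C
    c = proj₁ (binomial α e)
    c-vanishes : ∀ j → e < j → c j ≈ 0#
    c-vanishes = proj₁ (proj₂ (binomial α e))
    c' : ℕ → C
    c' j = α * c j + shiftSeq c j
    vanishes : ∀ j → suc e < j → c' j ≈ 0#
    vanishes (suc j) (s≤s lt) =
      trans (+-cong (trans (*-cong refl (c-vanishes (suc j) (NP.m<n⇒m<1+n lt))) (zeroʳ α)) (c-vanishes j lt)) (+-identityʳ 0#)
    expands : ∀ β → pow (α + β) (suc e) ≈ ∑ (suc (suc e)) (λ j → c' j * pow β j)
    expands β = begin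
      (α + β) * pow (α + β) e                     ≈⟨ *-cong refl (proj₂ (proj₂ (binomial α e)) β) ⟩
      (α + β) * ∑ (suc e) (λ j → c j * pow β j)   ≈⟨ trans (distribʳ _ _ _) (+-cong (∑-*ˡ (suc e) α _) (∑-*ˡ (suc e) β _)) ⟩
      ∑ (suc e) (λ j → α * (c j * pow β j)) + ∑ (suc e) (λ j → β * (c j * pow β j))
        ≈⟨ +-cong (sym (∑-extend (suc e) (suc (suc e)) (NP.n≤1+n _)
                    (λ j le _ → trans (*-cong refl (trans (*-cong (c-vanishes j le) refl) (zeroˡ _))) (zeroʳ α))))
                  (trans (sym (+-identityˡ _)) (+-cong (sym (zeroˡ _)) (∑-cong' (suc e) (λ j → *-left-commute β (c j) (pow β j))))) ⟩
      ∑ (suc (suc e)) (λ j → α * (c j * pow β j)) + (0# * pow β 0 + ∑ (suc e) (λ j → c j * pow β (suc j)))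
        ≈⟨ +-cong refl (sym (∑-suc (suc e) (λ j → shiftSeq c j * pow β j))) ⟩
      ∑ (suc (suc e)) (λ j → α * (c j * pow β j)) + ∑ (suc (suc e)) (λ j → shiftSeq c j * pow β j)
        ≈⟨ sym (∑-+ (suc (suc e)) _ _) ⟩
      ∑ (suc (suc e)) (λ j → α * (c j * pow β j) + shiftSeq c j * pow β j)
        ≈⟨ ∑-cong' (suc (suc e)) (λ j → trans (+-cong (sym (*-assoc _ _ _)) refl) (sym (distribʳ _ _ _))) ⟩
      ∑ (suc (suc e)) (λ j → c' j * pow β j) ∎

  -- The Hasse derivatives h_j = ∂ʲP(x, α) vanish for j > r, and so do their coefficients
  -- of degree > r.  Expanding (α + β)^e binomially writes Σ_j h_j β^j = P(x, α + β) as
  -- Σ_j e_j β^j with explicit coefficients e_j that visibly vanish in this range; the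
  -- identity theorem at the distinct points 0, 1, …, B then identifies h_j with e_j.
  naturals-distinct : CharZero → ∀ N → Distinct N embℕ
  naturals-distinct cz N a b _ _ = embℕ-injective cz a b

  module HasseVanishing (cz : CharZero) {n} (P : Expr (suc n)) (r : ℕ) (deg : DegAtMost (coeff P) r) (α : C) where
    B : ℕ
    B = degBound P

    h : Vec ℕ n → ℕ → C
    h m j = hasseAt j P α m

    binomCoeff : ℕ → ℕ → C
    binomCoeff e = proj₁ (binomial α e)

    -- the coefficient of β^j in Σ_e P_e(x) (α + β)^e
    expanded : Vec ℕ n → ℕ → C
    expanded m j = ∑ (suc B) (λ e → coeff P (e ∷ m) * binomCoeff e j)

    binomial-upTo : ∀ e β → e ≤ B → pow (α + β) e ≈ ∑ (suc B) (λ j → binomCoeff e j * pow β j)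
    binomial-upTo e β le = trans (proj₂ (proj₂ (binomial α e)) β)
      (sym (∑-extend (suc e) (suc B) (s≤s le) (λ j lt _ → trans (*-cong (proj₁ (proj₂ (binomial α e)) j lt) refl) (zeroˡ _))))

    -- the trivial range: the y-degree of P(x, y + z) is at most degBound P
    h-beyond : ∀ m j → B < j → h m j ≈ 0#
    h-beyond m j lt = ≡.subst (_≈ 0#) (≡.sym (hasseAt-evalSecond j P α m))
      (deg-evalSecond α B (deg-shiftY P) (j ∷ m) (NP.<-≤-trans lt (NP.m≤m+n j ∣ m ∣)))

    both-expansions : ∀ m β → ∑ (suc B) (λ j → h m j * pow β j) ≈ ∑ (suc B) (λ j → expanded m j * pow β j)
    both-expansions m β = begin
      ∑ (suc B) (λ j → h m j * pow β j)                 ≈⟨ taylor P α β m ⟩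
      ∑ (suc B) (λ e → coeff P (e ∷ m) * pow (α + β) e) ≈⟨ ∑-cong (suc B) (λ e lt → *-cong refl (binomial-upTo e β (NP.≤-pred lt))) ⟩
      ∑ (suc B) (λ e → coeff P (e ∷ m) * ∑ (suc B) (λ j → binomCoeff e j * pow β j))
        ≈⟨ ∑-cong' (suc B) (λ e → ∑-*ˡ (suc B) _ _) ⟩
      ∑ (suc B) (λ e → ∑ (suc B) (λ j → coeff P (e ∷ m) * (binomCoeff e j * pow β j)))
        ≈⟨ ∑-swap (suc B) (suc B) _ ⟩
      ∑ (suc B) (λ j → ∑ (suc B) (λ e → coeff P (e ∷ m) * (binomCoeff e j * pow β j)))
        ≈⟨ ∑-cong' (suc B) (λ j → trans (∑-cong' (suc B) (λ e → sym (*-assoc _ _ _))) (sym (∑-*ʳ (suc B) (pow β j) _))) ⟩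
      ∑ (suc B) (λ j → expanded m j * pow β j)          ∎

    -- the identity theorem at β = 0, …, B
    h≈expanded : ∀ m j → j ≤ B → h m j ≈ expanded m j
    h≈expanded m j le = poly-identity B embℕ (naturals-distinct cz B) (h m) (expanded m) (λ b _ → both-expansions m (embℕ b)) j le

    expanded-vanishes : ∀ m j → (r < j ⊎ r < ∣ m ∣) → expanded m j ≈ 0#
    expanded-vanishes m j (inj₂ lt) =
      ∑-0 (suc B) (λ e _ → trans (*-cong (deg (e ∷ m) (NP.<-≤-trans lt (∣∷∣ᵗ e m))) refl) (zeroˡ _))
    expanded-vanishes m j (inj₁ lt) = ∑-0 (suc B) (λ e _ → term e)
      where
      term : ∀ e → coeff P (e ∷ m) * binomCoeff e j ≈ 0#
      term e with j ℕ.≤? e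
      ... | yes j≤e = trans (*-cong (deg (e ∷ m) (NP.<-≤-trans (NP.<-≤-trans lt j≤e) (∣∷∣ʰ e m))) refl) (zeroˡ _)
      ... | no j≰e = trans (*-cong refl (proj₁ (proj₂ (binomial α e)) j (NP.≰⇒> j≰e))) (zeroʳ _)

    hasse-vanishes : ∀ m j → (r < j ⊎ r < ∣ m ∣) → h m j ≈ 0#
    hasse-vanishes m j c with j ℕ.≤? B
    ... | yes le = trans (h≈expanded m j le) (expanded-vanishes m j c)
    ... | no nle = h-beyond m j (NP.≰⇒> nle)

  indicator : Bool → C
  indicator b = if b then 1# else 0#

  window : ℕ → ℕ → C
  window d i = indicator (i ℕ.≤ᵇ d) - indicator (i ℕ.≡ᵇ 0)

  gElem-window : ∀ {n} (P : Expr (suc n)) α d J m → gElem P α d J m ≈ window d ∣ m ∣ * hasseAt J P α m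
  gElem-window P α d J m = sym (trans ([y-z]x≈yx-zx x (indicator b1) (indicator b2))
                                      (+-cong (sym (select b1)) (-‿cong (sym (select b2)))))
    where
    x : C
    x = hasseAt J P α m
    b1 : Bool
    b1 = ∣ m ∣ ℕ.≤ᵇ d
    b2 : Bool
    b2 = ∣ m ∣ ℕ.≡ᵇ 0
    select : ∀ (b : Bool) → (if b then x else 0#) ≈ indicator b * x
    select true = sym (*-identityˡ x)
    select false = sym (zeroˡ x)

  window-0 : ∀ d → window d 0 ≈ 0#
  window-0 d = -‿inverseʳ 1#

  window-above : ∀ d i → d < i → window d i ≈ 0#
  window-above d i lt with i ℕ.≤ᵇ d in e1 | i ℕ.≡ᵇ 0 in e2
  ... | true | _ = ⊥-elim (NP.<⇒≱ lt (NP.≤ᵇ⇒≤ i d (≡.subst T (≡.sym e1) _)))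
  ... | false | true = ⊥-elim (NP.<⇒≢ (NP.≤-<-trans z≤n lt) (≡.sym (NP.≡ᵇ⇒≡ i 0 (≡.subst T (≡.sym e2) _))))
  ... | false | false = -‿inverseʳ 0#

  window-1 : ∀ d → 1 ≤ d → window d 1 ≈ 1#
  window-1 (suc d) _ = trans (+-cong refl -0#≈0#) (+-identityʳ 1#)

  window-positive : ∀ d i {x y} → (1 ≤ i → x ≈ y) → window d i * x ≈ window d i * y
  window-positive d zero h = trans (*-cong (window-0 d) refl) (trans (zeroˡ _) (sym (trans (*-cong (window-0 d) refl) (zeroˡ _))))
  window-positive d (suc i) h = *-cong refl (h (s≤s z≤n))

  window-affine : ∀ d → 1 ≤ d → ∀ i x → (i ≡ 0 → x ≈ 0#) → (1 < i → x ≈ 0#) → window d i * x ≈ x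
  window-affine d d≥1 zero x h0 h2 = trans (*-cong (window-0 d) refl) (trans (zeroˡ _) (sym (h0 ≡.refl)))
  window-affine d d≥1 (suc zero) x h0 h2 = trans (*-cong (window-1 d d≥1) refl) (*-identityˡ _)
  window-affine d d≥1 (suc (suc i)) x h0 h2 = trans (*-cong refl (h2 (s≤s (s≤s z≤n)))) (trans (zeroʳ _) (sym (h2 (s≤s (s≤s z≤n)))))

  -- The interpolation formula  g_J(x) = Σ_{t, b ≤ r} μ_t ν_b P((t + 1) x, α + b):  the ν_b
  -- extract h_J from the values P(x, α + b) = Σ_j h_j b^j, and the μ_t realise the window
  -- on degrees ≤ r as a combination of the dilation factors (t + 1)^i.
  module Interpolation (cz : CharZero) {n} (P : Expr (suc n)) (r : ℕ) (deg : DegAtMost (coeff P) r) (α : C) (d J : ℕ) (J≤r : J ≤ r) where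
    open HasseVanishing cz P r deg α using (h; B; h-beyond; hasse-vanishes)

    τ : ℕ → C
    τ t = embℕ (suc t)

    τ-distinct : Distinct r τ
    τ-distinct a b _ _ ne = embℕ-injective cz (suc a) (suc b) (λ e → ne (NP.suc-injective e))

    extraction : Σ (ℕ → C) λ ν → ∀ (c : ℕ → C) → c J ≈ ∑ (suc r) (λ b → ν b * ∑ (suc r) (λ j → c j * pow (embℕ b) j))
    extraction = extract r embℕ (naturals-distinct cz r) J J≤r

    ν : ℕ → C
    ν = proj₁ extraction

    windowWeights : ∃ λ μ → ∀ i → i ≤ r → moment r τ μ i ≈ window d i
    windowWeights = vandermonde r τ τ-distinct (window d)

    μ : ℕ → C
    μ = proj₁ windowWeights

    -- the coefficient at m of P((t + 1) x, α + b)
    dilatedShift : Vec ℕ n → ℕ → ℕ → C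
    dilatedShift m t b = pow (τ t) ∣ m ∣ * evalHead (α + embℕ b) r (coeff P) m

    interpolant : Vec ℕ n → C
    interpolant m = ∑ (suc r) (λ t → ∑ (suc r) (λ b → (μ t * ν b) * dilatedShift m t b))

    -- Taylor's formula with r + 1 terms, which suffice as h_j = 0 for j > r
    taylor-r : ∀ m β → evalHead (α + β) r (coeff P) m ≈ ∑ (suc r) (λ j → h m j * pow β j)
    taylor-r m β = begin
      evalHead (α + β) r (coeff P) m     ≈⟨ evalHead-limits (α + β) r B deg (deg-coeff P) m ⟩
      evalHead (α + β) B (coeff P) m     ≈⟨ sym (taylor P α β m) ⟩
      ∑ (suc B) (λ j → h m j * pow β j)  ≈⟨ ∑-limits B r _ (λ j lt → trans (*-cong (h-beyond m j lt) refl) (zeroˡ _))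
                                                          (λ j lt → trans (*-cong (hasse-vanishes m j (inj₁ lt)) refl) (zeroˡ _)) ⟩
      ∑ (suc r) (λ j → h m j * pow β j)  ∎

    derivative-from-values : ∀ m → ∑ (suc r) (λ b → ν b * evalHead (α + embℕ b) r (coeff P) m) ≈ h m J
    derivative-from-values m = sym (trans (proj₂ extraction (h m))
      (∑-cong' (suc r) (λ b → *-cong refl (sym (taylor-r m (embℕ b))))))

    interpolant-factors : ∀ m → interpolant m ≈ ∑ (suc r) (λ t → μ t * pow (τ t) ∣ m ∣) * h m J
    interpolant-factors m = begin
      interpolant m
        ≈⟨ ∑-cong' (suc r) (λ t → ∑-cong' (suc r) (λ b → *-interchange (μ t) (ν b) _ _)) ⟩
      ∑ (suc r) (λ t → ∑ (suc r) (λ b → (μ t * pow (τ t) ∣ m ∣) * (ν b * evalHead (α + embℕ b) r (coeff P) m)))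
        ≈⟨ ∑-cong' (suc r) (λ t → trans (sym (∑-*ˡ (suc r) _ _)) (*-cong refl (derivative-from-values m))) ⟩
      ∑ (suc r) (λ t → (μ t * pow (τ t) ∣ m ∣) * h m J)
        ≈⟨ sym (∑-*ʳ (suc r) _ _) ⟩
      ∑ (suc r) (λ t → μ t * pow (τ t) ∣ m ∣) * h m J ∎

    -- the interpolation formula; above degree r both sides vanish
    gElem-interpolation : ∀ m → gElem P α d J m ≈ interpolant m
    gElem-interpolation m with ∣ m ∣ ℕ.≤? r
    ... | yes le = trans (gElem-window P α d J m) (sym (trans (interpolant-factors m) (*-cong (proj₂ windowWeights ∣ m ∣ le) refl)))
    ... | no nle = trans (gElem-window P α d J m) (trans (*-cong refl hJ0)
                     (trans (zeroʳ _) (sym (trans (interpolant-factors m) (trans (*-cong refl hJ0) (zeroʳ _))))))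
      where hJ0 = hasse-vanishes m J (inj₂ (NP.≰⇒> nle))

  module Specialisation (τ β : C) where
    specialise : ∀ {n} → ℕ → Coeffs (suc n) → Coeffs n
    specialise B f = dilate τ (evalHead β B f)

    Specialises : ∀ {n} → Coeffs n → Expr (suc n) → Set ℓ
    Specialises f e = f ≐ specialise (degBound e) (coeff e)

    Specialises-cong : ∀ {n} {f f' : Coeffs n} {e} → f ≐ f' → Specialises f e → Specialises f' e
    Specialises-cong h r m = trans (sym (h m)) (r m)

    Specialises-⊕ : ∀ {n} {f1 f2 : Coeffs n} {e1 e2} → Specialises f1 e1 → Specialises f2 e2 → Specialises (λ m → f1 m + f2 m) (e1 ⊕ e2)
    Specialises-⊕ {f1 = f1} {f2} {e1} {e2} r1 r2 m = begin
      f1 m + f2 m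
        ≈⟨ +-cong (r1 m) (r2 m) ⟩
      specialise B1 (coeff e1) m + specialise B2 (coeff e2) m
        ≈⟨ sym (+-cong (*-cong refl (evalHead-bound β B (deg-coeff e1) (NP.m≤m⊔n B1 B2) m))
                       (*-cong refl (evalHead-bound β B (deg-coeff e2) (NP.m≤n⊔m B1 B2) m))) ⟩
      specialise B (coeff e1) m + specialise B (coeff e2) m
        ≈⟨ sym (trans (*-cong refl (evalHead-+ β B (coeff e1) (coeff e2) m)) (distribˡ _ _ _)) ⟩
      specialise B (coeff (e1 ⊕ e2)) m ∎
      where
      B1 : ℕ
      B1 = degBound e1
      B2 : ℕ
      B2 = degBound e2
      B : ℕ
      B = B1 ℕ.⊔ B2

    Specialises-⊗ : ∀ {n} {f1 f2 : Coeffs n} {e1 e2} → Specialises f1 e1 → Specialises f2 e2 → Specialises (conv f1 f2) (e1 ⊗ e2)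
    Specialises-⊗ {f1 = f1} {f2} {e1} {e2} r1 r2 m = begin
      conv f1 f2 m
        ≈⟨ conv-cong r1 r2 m ⟩
      conv (specialise B1 (coeff e1)) (specialise B2 (coeff e2)) m
        ≈⟨ sym (dilate-mult τ (evalHead β B1 (coeff e1)) (evalHead β B2 (coeff e2)) m) ⟩
      dilate τ (conv (evalHead β B1 (coeff e1)) (evalHead β B2 (coeff e2))) m
        ≈⟨ dilate-cong τ (λ v → sym (evalHead-mult β (deg-coeff e1) (deg-coeff e2) v)) m ⟩
      specialise (B1 ℕ.+ B2) (coeff (e1 ⊗ e2)) m ∎
      where
      B1 : ℕ
      B1 = degBound e1
      B2 : ℕ
      B2 = degBound e2

    Specialises-con : ∀ {n} c → Specialises {n} (constP c) (con c)
    Specialises-con c m = sym (begin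
      pow τ ∣ m ∣ * ∑ 1 (λ e → constP c (e ∷ m) * pow β e) ≈⟨ *-cong refl (trans (∑-one _) (*-identityʳ _)) ⟩
      pow τ ∣ m ∣ * constP c m                              ≈⟨ dilate-const τ c m ⟩
      constP c m                                            ∎)

    Specialises-y : ∀ {n} → Specialises {n} (constP β) (var zero)
    Specialises-y m = sym (begin
      pow τ ∣ m ∣ * ∑ 2 (λ e → coeff (var zero) (e ∷ m) * pow β e)
        ≈⟨ *-cong refl (∑-two _) ⟩
      pow τ ∣ m ∣ * (0# * 1# + constP 1# m * (β * 1#))
        ≈⟨ *-cong refl (trans (+-cong (zeroˡ _) (trans (*-comm _ _) (sym (constP-* (β * 1#) 1# m)))) (+-identityˡ _)) ⟩
      pow τ ∣ m ∣ * constP (β * 1# * 1#) m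
        ≈⟨ dilate-const τ _ m ⟩
      constP (β * 1# * 1#) m
        ≈⟨ constP-cong (trans (*-identityʳ _) (*-identityʳ β)) m ⟩
      constP β m ∎)

    Specialises-x : ∀ {n} (i : Fin n) → Specialises (λ m → τ * varP i m) (var (suc i))
    Specialises-x i m = sym (begin
      pow τ ∣ m ∣ * ∑ 2 (λ e → coeff (var (suc i)) (e ∷ m) * pow β e)
        ≈⟨ *-cong refl (∑-two _) ⟩
      pow τ ∣ m ∣ * (varP i m * 1# + 0# * (β * 1#))
        ≈⟨ *-cong refl (trans (+-cong (*-identityʳ _) (zeroˡ _)) (+-identityʳ _)) ⟩
      pow τ ∣ m ∣ * varP i m
        ≈⟨ linear ⟩
      τ * varP i m ∎)
      where
      linear : pow τ ∣ m ∣ * varP i m ≈ τ * varP i m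
      linear with isUnit i m in eq
      ... | true = *-cong (trans (reflexive (≡.cong (pow τ) (isUnit⇒1 i m eq))) (*-identityʳ τ)) refl
      ... | false = trans (zeroʳ _) (sym (zeroʳ _))

  gate : ∀ {k w} → Bool → Vec (Expr k) w → List⁺ (Fin w) → Expr k
  gate b E g = (if b then sumE else prodE) (toList (List⁺.map (Vec.lookup E) g))

  evalL-▷ : ∀ {k Δ w w'} b (L : Layers k Δ w) (gs : Vec (List⁺ (Fin w)) w') i →
    Vec.lookup (evalL b (L ▷ gs)) i ≡ gate b (evalL (not b) L) (Vec.lookup gs i)
  evalL-▷ b L gs i = VP.lookup-map i _ gs

  sumE-++ : ∀ {k} (xs ys : List (Expr k)) m → coeff (sumE (xs ++ ys)) m ≈ coeff (sumE xs) m + coeff (sumE ys) m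
  sumE-++ [] ys m = sym (trans (+-cong (constP-0 m) refl) (+-identityˡ _))
  sumE-++ (x ∷ xs) ys m = trans (+-cong refl (sumE-++ xs ys m)) (sym (+-assoc _ _ _))

  wires : ∀ {w w'} → Vec (List⁺ (Fin w)) w' → ℕ
  wires gs = Vec.sum (Vec.map List⁺.length gs)

  wires-map : ∀ {w u w'} (f : Fin w → Fin u) (gs : Vec (List⁺ (Fin w)) w') → wires (Vec.map (List⁺.map f) gs) ≡ wires gs
  wires-map f [] = ≡.refl
  wires-map f ((x ∷ xs) ∷ gs) = ≡.cong₂ ℕ._+_ (≡.cong suc (LP.length-map f xs)) (wires-map f gs)

  wires-++ : ∀ {w m1 m2} (g1 : Vec (List⁺ (Fin w)) m1) (g2 : Vec (List⁺ (Fin w)) m2) → wires (g1 Vec.++ g2) ≡ wires g1 ℕ.+ wires g2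
  wires-++ [] g2 = ≡.refl
  wires-++ (x ∷ g1) g2 = ≡.trans (≡.cong (List⁺.length x ℕ.+_) (wires-++ g1 g2)) (≡.sym (NP.+-assoc (List⁺.length x) _ _))

  width≤wires : ∀ {w w'} (gs : Vec (List⁺ (Fin w)) w') → w' ≤ wires gs
  width≤wires [] = z≤n
  width≤wires ((x ∷ xs) ∷ gs) = NP.+-mono-≤ (s≤s z≤n) (width≤wires gs)

  -- a path from the top to the leaves uses one wire per layer
  depth≤size : ∀ {k Δ w} (L : Layers k Δ w) → Fin w → Δ ≤ size L
  depth≤size (leaves _) _ = z≤n
  depth≤size {Δ = suc Δ} (L ▷ gs@(_ ∷ _)) i =
    NP.≤-trans (NP.≤-reflexive (NP.+-comm 1 Δ))
      (NP.+-mono-≤ (depth≤size L (List⁺.head (Vec.lookup gs i))) (NP.≤-trans (s≤s z≤n) (width≤wires gs)))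

  par : ∀ {k Δ w1 w2} → Layers k Δ w1 → Layers k Δ w2 → Layers k Δ (w1 ℕ.+ w2)
  par (leaves v1) (leaves v2) = leaves (v1 Vec.++ v2)
  par (_▷_ {w = u1} L1 g1) (_▷_ {w = u2} L2 g2) =
    par L1 L2 ▷ (Vec.map (List⁺.map (_↑ˡ u2)) g1 Vec.++ Vec.map (List⁺.map (u1 ↑ʳ_)) g2)

  gate-↑ˡ : ∀ {k u1 u2} b (E1 : Vec (Expr k) u1) (E2 : Vec (Expr k) u2) g →
    gate b (E1 Vec.++ E2) (List⁺.map (_↑ˡ u2) g) ≡ gate b E1 g
  gate-↑ˡ b E1 E2 g = ≡.cong (if b then sumE else prodE)
    (≡.trans (≡.sym (LP.map-∘ (toList g))) (LP.map-cong (VP.lookup-++ˡ E1 E2) (toList g)))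

  gate-↑ʳ : ∀ {k u1 u2} b (E1 : Vec (Expr k) u1) (E2 : Vec (Expr k) u2) g →
    gate b (E1 Vec.++ E2) (List⁺.map (u1 ↑ʳ_) g) ≡ gate b E2 g
  gate-↑ʳ b E1 E2 g = ≡.cong (if b then sumE else prodE)
    (≡.trans (≡.sym (LP.map-∘ (toList g))) (LP.map-cong (VP.lookup-++ʳ E1 E2) (toList g)))

  par-eval : ∀ {k Δ w1 w2} b (L1 : Layers k Δ w1) (L2 : Layers k Δ w2) → evalL b (par L1 L2) ≡ evalL b L1 Vec.++ evalL b L2
  par-eval b (leaves v1) (leaves v2) = VP.map-++ leafE v1 v2
  par-eval {k} b (_▷_ {w = u1} L1 g1) (_▷_ {w = u2} L2 g2) rewrite par-eval (not b) L1 L2 =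
    ≡.trans (VP.map-++ (gate b (E1 Vec.++ E2)) (Vec.map (List⁺.map (_↑ˡ u2)) g1) (Vec.map (List⁺.map (u1 ↑ʳ_)) g2))
      (≡.cong₂ Vec._++_
        (≡.trans (≡.sym (VP.map-∘ _ _ g1)) (VP.map-cong (gate-↑ˡ b E1 E2) g1))
        (≡.trans (≡.sym (VP.map-∘ _ _ g2)) (VP.map-cong (gate-↑ʳ b E1 E2) g2)))
    where
    E1 : Vec (Expr k) u1
    E1 = evalL (not b) L1
    E2 : Vec (Expr k) u2
    E2 = evalL (not b) L2

  par-size : ∀ {k Δ w1 w2} (L1 : Layers k Δ w1) (L2 : Layers k Δ w2) → size (par L1 L2) ≡ size L1 ℕ.+ size L2
  par-size (leaves v1) (leaves v2) = ≡.refl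
  par-size (_▷_ {w = u1} L1 g1) (_▷_ {w = u2} L2 g2) rewrite par-size L1 L2
    | wires-++ (Vec.map (List⁺.map (_↑ˡ u2)) g1) (Vec.map (List⁺.map (u1 ↑ʳ_)) g2)
    | wires-map (_↑ˡ u2) g1 | wires-map (u1 ↑ʳ_) g2 = +-interchangeℕ (size L1) (size L2) (wires g1) (wires g2)

  emptyL : ∀ {k} Δ → Layers k Δ 0
  emptyL zero = leaves []
  emptyL (suc Δ) = emptyL Δ ▷ []

  emptyL-size : ∀ {k} Δ → size (emptyL {k} Δ) ≡ 0
  emptyL-size zero = ≡.refl
  emptyL-size (suc Δ) = ≡.trans (NP.+-identityʳ _) (emptyL-size Δ)

  -- a constant carried up through Δ layers by gates of fan-in one
  chain : ∀ {k} → C → ∀ Δ → Layers k Δ 1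
  chain c zero = leaves (lcon c ∷ [])
  chain c (suc Δ) = chain c Δ ▷ ((zero ∷ []) ∷ [])

  chain-size : ∀ {k} c Δ → size (chain {k} c Δ) ≡ Δ
  chain-size c zero = ≡.refl
  chain-size c (suc Δ) = ≡.trans (NP.+-comm (size (chain c Δ)) 1) (≡.cong suc (chain-size c Δ))

  chain-sem : ∀ {k} c Δ b → coeff (Vec.lookup (evalL b (chain {k} c Δ)) zero) ≐ constP c
  chain-sem c zero b m = refl
  chain-sem c (suc Δ) true m = trans (+-cong (chain-sem c Δ false m) (constP-0 m)) (+-identityʳ _)
  chain-sem c (suc Δ) false m = begin
    conv (coeff (Vec.lookup (evalL true (chain c Δ)) zero)) (constP 1#) m ≈⟨ conv-cong (chain-sem c Δ true) (λ _ → refl) m ⟩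
    conv (constP c) (constP 1#) m  ≈⟨ conv-const c (constP 1#) m ⟩
    c * constP 1# m                ≈⟨ sym (constP-* c 1# m) ⟩
    constP (c * 1#) m              ≈⟨ constP-cong (*-identityʳ c) m ⟩
    constP c m                     ∎

  -- Rewiring a circuit for P(x, y) into one for P(τ x, β), τ = t + 1, of the same depth
  -- (at least 1).  Only the lowest gate layer changes: a new leaf carrying τ is added, the
  -- leaf y becomes the constant β, and a wire from a leaf x_i into a sum gate is repeated
  -- t + 1 times, while a wire from x_i into a product gate gets a companion wire from τ.
  -- Every wire is replaced by at most t + 2 wires.
  module Rewire (t : ℕ) (β : C) where
    τ : C
    τ = embℕ (suc t)

    open Specialisation τ β public

    specLeaf : ∀ {n} → Leaf (suc n) → Leaf n
    specLeaf (lvar zero) = lcon β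
    specLeaf (lvar (suc i)) = lvar i
    specLeaf (lcon c) = lcon c

    -- the wires replacing one wire from leaf x (node 0 is the new leaf τ)
    leafWires : ∀ {n w} → Bool → Leaf (suc n) → Fin w → List⁺ (Fin (suc w))
    leafWires true (lvar (suc _)) x = suc x ∷ List.replicate t (suc x)
    leafWires false (lvar (suc _)) x = suc x ∷ zero ∷ []
    leafWires b (lvar zero) x = suc x ∷ []
    leafWires b (lcon _) x = suc x ∷ []

    rewireWires : ∀ {n w} → Bool → Vec (Leaf (suc n)) w → List (Fin w) → List (Fin (suc w))
    rewireWires b ls [] = []
    rewireWires b ls (x ∷ xs) = toList (leafWires b (Vec.lookup ls x) x) ++ rewireWires b ls xs

    rewireGate : ∀ {n w} → Bool → Vec (Leaf (suc n)) w → List⁺ (Fin w) → List⁺ (Fin (suc w))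
    rewireGate b ls (x ∷ xs) =
      List⁺.head (leafWires b (Vec.lookup ls x) x) ∷ (List⁺.tail (leafWires b (Vec.lookup ls x) x) ++ rewireWires b ls xs)

    toList-rewireGate : ∀ {n w} b (ls : Vec (Leaf (suc n)) w) g → toList (rewireGate b ls g) ≡ rewireWires b ls (toList g)
    toList-rewireGate b ls (x ∷ xs) with leafWires b (Vec.lookup ls x) x
    ... | _ ∷ _ = ≡.refl

    -- the Bool records whether the top layer consists of sum gates
    rewire : ∀ {n Δ w} → Bool → Layers (suc n) (suc Δ) w → Layers n (suc Δ) w
    rewire b (leaves ls ▷ gs) = leaves (lcon τ ∷ Vec.map specLeaf ls) ▷ Vec.map (rewireGate b ls) gs
    rewire b ((L ▷ gs') ▷ gs) = rewire (not b) (L ▷ gs') ▷ gs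

    -- what the wires from one leaf contribute, as a summand or as a factor
    leafValue : ∀ {n} → Leaf (suc n) → Coeffs n
    leafValue (lvar zero) = constP β
    leafValue (lvar (suc i)) = λ m → τ * varP i m
    leafValue (lcon c) = constP c

    leafValue-specialises : ∀ {n} (l : Leaf (suc n)) → Specialises (leafValue l) (leafE l)
    leafValue-specialises (lvar zero) = Specialises-y
    leafValue-specialises (lvar (suc i)) = Specialises-x i
    leafValue-specialises (lcon c) = Specialises-con c

    repeated-sum : ∀ {n} (i : Fin n) s m → coeff (sumE (List.replicate s (var i))) m ≈ embℕ s * varP i m
    repeated-sum i zero m = trans (constP-0 m) (sym (zeroˡ _))
    repeated-sum i (suc s) m = trans (+-cong refl (repeated-sum i s m)) (trans (+-cong (sym (*-identityˡ _)) refl) (sym (distribʳ _ _ _)))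

    -- f lists the nodes of the new bottom layer; node 0 is the constant τ
    module _ {n w} (f : Fin (suc w) → Expr n) (f0 : f zero ≡ con τ) where
      leafWires-sum : ∀ (l : Leaf (suc n)) x → f (suc x) ≡ leafE (specLeaf l) → ∀ R m →
        coeff (sumE (map f (toList (leafWires true l x) ++ R))) m ≈ leafValue l m + coeff (sumE (map f R)) m
      leafWires-sum (lvar zero) x eq R m rewrite eq = refl
      leafWires-sum (lcon c) x eq R m rewrite eq = refl
      leafWires-sum (lvar (suc i)) x eq R m = begin
        coeff (sumE (map f (copies ++ R))) m
          ≡⟨ ≡.cong (λ z → coeff (sumE z) m) (LP.map-++ f copies R) ⟩
        coeff (sumE (map f copies ++ map f R)) m
          ≈⟨ sumE-++ (map f copies) (map f R) m ⟩
        coeff (sumE (map f copies)) m + coeff (sumE (map f R)) m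
          ≡⟨ ≡.cong (λ z → coeff (sumE z) m + coeff (sumE (map f R)) m)
                    (≡.trans (LP.map-replicate f (suc t) (suc x)) (≡.cong (List.replicate (suc t)) eq)) ⟩
        coeff (sumE (List.replicate (suc t) (var i))) m + coeff (sumE (map f R)) m
          ≈⟨ +-cong (repeated-sum i (suc t) m) refl ⟩
        τ * varP i m + coeff (sumE (map f R)) m ∎
        where
        copies : List (Fin (suc w))
        copies = suc x ∷ List.replicate t (suc x)

      leafWires-prod : ∀ (l : Leaf (suc n)) x → f (suc x) ≡ leafE (specLeaf l) → ∀ R m →
        coeff (prodE (map f (toList (leafWires false l x) ++ R))) m ≈ conv (leafValue l) (coeff (prodE (map f R))) m
      leafWires-prod (lvar zero) x eq R m rewrite eq = refl
      leafWires-prod (lcon c) x eq R m rewrite eq = refl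
      leafWires-prod (lvar (suc i)) x eq R m rewrite eq | f0 = begin
        conv (varP i) (conv (constP τ) (coeff (prodE (map f R)))) m
          ≈⟨ conv-cong {f = varP i} (λ _ → refl) (conv-const τ _) m ⟩
        conv (varP i) (λ v → τ * coeff (prodE (map f R)) v) m
          ≈⟨ conv-*ʳ τ (varP i) _ m ⟩
        τ * conv (varP i) (coeff (prodE (map f R))) m
          ≈⟨ sym (conv-*ˡ τ (varP i) _ m) ⟩
        conv (λ v → τ * varP i v) (coeff (prodE (map f R))) m ∎

    module _ {n w} (E' : Vec (Expr n) w) (E : Vec (Expr (suc n)) w) (hE : ∀ j → Specialises (coeff (Vec.lookup E' j)) (Vec.lookup E j)) where
      sum-specialises : ∀ xs → Specialises (coeff (sumE (map (Vec.lookup E') xs))) (sumE (map (Vec.lookup E) xs))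
      sum-specialises [] = Specialises-con 0#
      sum-specialises (x ∷ xs) = Specialises-⊕ {e1 = Vec.lookup E x} {e2 = sumE (map (Vec.lookup E) xs)} (hE x) (sum-specialises xs)

      prod-specialises : ∀ xs → Specialises (coeff (prodE (map (Vec.lookup E') xs))) (prodE (map (Vec.lookup E) xs))
      prod-specialises [] = Specialises-con 1#
      prod-specialises (x ∷ xs) = Specialises-⊗ {e1 = Vec.lookup E x} {e2 = prodE (map (Vec.lookup E) xs)} (hE x) (prod-specialises xs)

      gate-specialises : ∀ b g → Specialises (coeff (gate b E' g)) (gate b E g)
      gate-specialises true g = sum-specialises (toList g)
      gate-specialises false g = prod-specialises (toList g)

    module _ {n w} (ls : Vec (Leaf (suc n)) w) where
      newLeaves : Vec (Expr n) (suc w)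
      newLeaves = Vec.map leafE (lcon τ ∷ Vec.map specLeaf ls)

      oldLeaves : Vec (Expr (suc n)) w
      oldLeaves = Vec.map leafE ls

      newLeaf-suc : ∀ x → Vec.lookup newLeaves (suc x) ≡ leafE (specLeaf (Vec.lookup ls x))
      newLeaf-suc x = ≡.trans (VP.lookup-map x leafE (Vec.map specLeaf ls)) (≡.cong leafE (VP.lookup-map x specLeaf ls))

      oldLeaf-specialises : ∀ x → Specialises (leafValue (Vec.lookup ls x)) (Vec.lookup oldLeaves x)
      oldLeaf-specialises x = ≡.subst (Specialises (leafValue (Vec.lookup ls x))) (≡.sym (VP.lookup-map x leafE ls))
                                      (leafValue-specialises (Vec.lookup ls x))

      rewired-sum : ∀ xs → Specialises (coeff (sumE (map (Vec.lookup newLeaves) (rewireWires true ls xs)))) (sumE (map (Vec.lookup oldLeaves) xs))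
      rewired-sum [] = Specialises-con 0#
      rewired-sum (x ∷ xs) =
        Specialises-cong {e = sumE (map (Vec.lookup oldLeaves) (x ∷ xs))}
          (λ m → sym (leafWires-sum (Vec.lookup newLeaves) ≡.refl (Vec.lookup ls x) x (newLeaf-suc x) (rewireWires true ls xs) m))
          (Specialises-⊕ {e1 = Vec.lookup oldLeaves x} {e2 = sumE (map (Vec.lookup oldLeaves) xs)} (oldLeaf-specialises x) (rewired-sum xs))

      rewired-prod : ∀ xs → Specialises (coeff (prodE (map (Vec.lookup newLeaves) (rewireWires false ls xs)))) (prodE (map (Vec.lookup oldLeaves) xs))
      rewired-prod [] = Specialises-con 1#
      rewired-prod (x ∷ xs) =
        Specialises-cong {e = prodE (map (Vec.lookup oldLeaves) (x ∷ xs))}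
          (λ m → sym (leafWires-prod (Vec.lookup newLeaves) ≡.refl (Vec.lookup ls x) x (newLeaf-suc x) (rewireWires false ls xs) m))
          (Specialises-⊗ {e1 = Vec.lookup oldLeaves x} {e2 = prodE (map (Vec.lookup oldLeaves) xs)} (oldLeaf-specialises x) (rewired-prod xs))

      rewired-gate : ∀ b g → Specialises (coeff (gate b newLeaves (rewireGate b ls g))) (gate b oldLeaves g)
      rewired-gate true g = ≡.subst (λ z → Specialises (coeff (sumE (map (Vec.lookup newLeaves) z))) (gate true oldLeaves g))
                                    (≡.sym (toList-rewireGate true ls g)) (rewired-sum (toList g))
      rewired-gate false g = ≡.subst (λ z → Specialises (coeff (prodE (map (Vec.lookup newLeaves) z))) (gate false oldLeaves g))
                                     (≡.sym (toList-rewireGate false ls g)) (rewired-prod (toList g))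

    rewire-specialises : ∀ {n Δ w} b (L : Layers (suc n) (suc Δ) w) i →
      Specialises (coeff (Vec.lookup (evalL b (rewire b L)) i)) (Vec.lookup (evalL b L) i)
    rewire-specialises b (leaves ls ▷ gs) i
      rewrite evalL-▷ b (leaves (lcon τ ∷ Vec.map specLeaf ls)) (Vec.map (rewireGate b ls) gs) i
            | evalL-▷ b (leaves ls) gs i
            | VP.lookup-map i (rewireGate b ls) gs = rewired-gate ls b (Vec.lookup gs i)
    rewire-specialises b ((L ▷ gs') ▷ gs) i
      rewrite evalL-▷ b (rewire (not b) (L ▷ gs')) gs i
            | evalL-▷ b (L ▷ gs') gs i =
      gate-specialises (evalL (not b) (rewire (not b) (L ▷ gs'))) (evalL (not b) (L ▷ gs'))
                       (rewire-specialises (not b) (L ▷ gs')) b (Vec.lookup gs i)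

    leafWires-length : ∀ {n w} b (l : Leaf (suc n)) (x : Fin w) → List⁺.length (leafWires b l x) ≤ suc (suc t)
    leafWires-length true (lvar (suc _)) x = NP.≤-trans (NP.≤-reflexive (≡.cong suc (LP.length-replicate t))) (NP.n≤1+n _)
    leafWires-length false (lvar (suc _)) x = s≤s (s≤s z≤n)
    leafWires-length true (lvar zero) x = s≤s z≤n
    leafWires-length false (lvar zero) x = s≤s z≤n
    leafWires-length true (lcon _) x = s≤s z≤n
    leafWires-length false (lcon _) x = s≤s z≤n

    rewireWires-length : ∀ {n w} b (ls : Vec (Leaf (suc n)) w) xs → List.length (rewireWires b ls xs) ≤ suc (suc t) ℕ.* List.length xs
    rewireWires-length b ls [] = z≤n
    rewireWires-length b ls (x ∷ xs) =
      NP.≤-trans (NP.≤-reflexive (LP.length-++ (toList (leafWires b (Vec.lookup ls x) x))))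
        (NP.≤-trans (NP.+-mono-≤ (leafWires-length b (Vec.lookup ls x) x) (rewireWires-length b ls xs))
                    (NP.≤-reflexive (≡.sym (NP.*-suc (suc (suc t)) _))))

    rewireGates-wires : ∀ {n w w'} b (ls : Vec (Leaf (suc n)) w) (gs : Vec (List⁺ (Fin w)) w') →
      wires (Vec.map (rewireGate b ls) gs) ≤ suc (suc t) ℕ.* wires gs
    rewireGates-wires b ls [] = z≤n
    rewireGates-wires b ls (g ∷ gs) =
      NP.≤-trans (NP.+-mono-≤ gateBound (rewireGates-wires b ls gs))
                 (NP.≤-reflexive (≡.sym (NP.*-distribˡ-+ (suc (suc t)) (List⁺.length g) (wires gs))))
      where
      gateBound : List⁺.length (rewireGate b ls g) ≤ suc (suc t) ℕ.* List⁺.length g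
      gateBound = ≡.subst (_≤ suc (suc t) ℕ.* List⁺.length g) (≡.cong List.length (≡.sym (toList-rewireGate b ls g)))
                          (rewireWires-length b ls (toList g))

    rewire-size : ∀ {n Δ w} b (L : Layers (suc n) (suc Δ) w) → size (rewire b L) ≤ suc (suc t) ℕ.* size L
    rewire-size b (leaves ls ▷ gs) = rewireGates-wires b ls gs
    rewire-size b ((L ▷ gs') ▷ gs) =
      NP.≤-trans (NP.+-mono-≤ (rewire-size (not b) (L ▷ gs')) (NP.m≤n*m (wires gs) (suc (suc t))))
                 (NP.≤-reflexive (≡.sym (NP.*-distribˡ-+ (suc (suc t)) (size (L ▷ gs')) (wires gs))))

  -- Multiplying every gate of a top product layer by a constant c: each gate gets one more
  -- wire, from a chain carrying c up to that layer.
  withConstant : ∀ {u} → List⁺ (Fin u) → List⁺ (Fin (u ℕ.+ 1))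
  withConstant {u} g = (u ↑ʳ zero) ∷ toList (List⁺.map (_↑ˡ 1) g)

  scale : ∀ {n D w} → C → Layers n (suc D) w → Layers n (suc D) w
  scale {D = D} c (L ▷ gs) = par L (chain c D) ▷ Vec.map withConstant gs

  gate-withConstant : ∀ {n u} (E1 : Vec (Expr n) u) (E2 : Vec (Expr n) 1) g →
    gate false (E1 Vec.++ E2) (withConstant g) ≡ Vec.lookup E2 zero ⊗ gate false E1 g
  gate-withConstant E1 E2 g = ≡.cong₂ _⊗_ (VP.lookup-++ʳ E1 E2 zero)
    (≡.cong prodE (≡.trans (≡.sym (LP.map-∘ (toList g))) (LP.map-cong (VP.lookup-++ˡ E1 E2) (toList g))))

  scale-sem : ∀ {n D w} c (L : Layers n (suc D) w) i →
    coeff (Vec.lookup (evalL false (scale c L)) i) ≐ λ m → c * coeff (Vec.lookup (evalL false L) i) m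
  scale-sem {D = D} c (L ▷ gs) i m = begin
    coeff (Vec.lookup (evalL false (scale c (L ▷ gs))) i) m
      ≡⟨ ≡.cong (λ z → coeff z m) topGate ⟩
    coeff (Vec.lookup (evalL true (chain c D)) zero ⊗ gate false (evalL true L) (Vec.lookup gs i)) m
      ≈⟨ conv-cong (chain-sem c D true) (λ _ → refl) m ⟩
    conv (constP c) (coeff (gate false (evalL true L) (Vec.lookup gs i))) m
      ≈⟨ conv-const c _ m ⟩
    c * coeff (gate false (evalL true L) (Vec.lookup gs i)) m
      ≡⟨ ≡.cong (λ z → c * coeff z m) (≡.sym (evalL-▷ false L gs i)) ⟩
    c * coeff (Vec.lookup (evalL false (L ▷ gs)) i) m ∎
    where
    topGate : Vec.lookup (evalL false (scale c (L ▷ gs))) i ≡ Vec.lookup (evalL true (chain c D)) zero ⊗ gate false (evalL true L) (Vec.lookup gs i)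
    topGate = ≡.trans (evalL-▷ false (par L (chain c D)) (Vec.map withConstant gs) i)
               (≡.trans (≡.cong (gate false (evalL true (par L (chain c D)))) (VP.lookup-map i withConstant gs))
                 (≡.trans (≡.cong (λ E → gate false E (withConstant (Vec.lookup gs i))) (par-eval true L (chain c D)))
                   (gate-withConstant (evalL true L) (evalL true (chain c D)) (Vec.lookup gs i))))

  wires-withConstant : ∀ {u w'} (gs : Vec (List⁺ (Fin u)) w') → wires (Vec.map withConstant gs) ≡ wires gs ℕ.+ w'
  wires-withConstant [] = ≡.refl
  wires-withConstant ((x ∷ xs) ∷ gs) rewrite wires-withConstant gs | LP.length-map (_↑ˡ 1) xs =
    rearrange (List.length xs) (wires gs) _
    where
    rearrange : ∀ a b c → suc (suc a) ℕ.+ (b ℕ.+ c) ≡ suc a ℕ.+ b ℕ.+ suc c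
    rearrange = solve-∀

  -- scaling costs the chain and one extra wire per top gate
  scale-size : ∀ {n D w} c (L : Layers n (suc D) w) → size (scale c L) ≤ D ℕ.+ 2 ℕ.* size L
  scale-size {n} {D} c (_▷_ {w' = w} L gs) =
    NP.≤-trans (NP.≤-reflexive sizeEq)
      (NP.≤-trans (NP.+-monoʳ-≤ (size L ℕ.+ D) (NP.+-monoʳ-≤ (wires gs) (width≤wires gs)))
                  (rearrange (size L) D (wires gs)))
    where
    sizeEq : size (scale c (L ▷ gs)) ≡ size L ℕ.+ D ℕ.+ (wires gs ℕ.+ w)
    sizeEq = ≡.cong₂ ℕ._+_ (≡.trans (par-size L (chain c D)) (≡.cong (size L ℕ.+_) (chain-size {n} c D))) (wires-withConstant gs)
    rearrange : ∀ a b c → a ℕ.+ b ℕ.+ (c ℕ.+ c) ≤ b ℕ.+ 2 ℕ.* (a ℕ.+ c)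
    rearrange a b c = NP.≤-trans (NP.m≤m+n (a ℕ.+ b ℕ.+ (c ℕ.+ c)) a) (NP.≤-reflexive (regroup a b c))
      where
      regroup : ∀ a b c → a ℕ.+ b ℕ.+ (c ℕ.+ c) ℕ.+ a ≡ b ℕ.+ 2 ℕ.* (a ℕ.+ c)
      regroup = solve-∀

  -- Summands: a stack of layers of depth D with top product layer, together with a list of
  -- top nodes whose sum is meant; a final sum gate over them yields a circuit of depth D + 1.
  -- Summands combine by parallel composition, with values and sizes adding up.
  Summands : ℕ → ℕ → Set a
  Summands n D = Σ ℕ λ w → Layers n D w × List (Fin w)

  -- the polynomial represented by a family of summands and its size including the final gate's wires
  value : ∀ {n D} → Summands n D → Coeffs n
  value (w , L , top) = coeff (sumE (map (Vec.lookup (evalL false L)) top))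

  summandsSize : ∀ {n D} → Summands n D → ℕ
  summandsSize (w , L , top) = size L ℕ.+ List.length top

  combine : ∀ {n D} → Summands n D → Summands n D → Summands n D
  combine (w1 , L1 , t1) (w2 , L2 , t2) = (w1 ℕ.+ w2 , par L1 L2 , map (_↑ˡ w2) t1 ++ map (w1 ↑ʳ_) t2)

  value-combine : ∀ {n D} (p q : Summands n D) m → value (combine p q) m ≈ value p m + value q m
  value-combine {n} (w1 , L1 , t1) (w2 , L2 , t2) m = begin
    coeff (sumE (map (Vec.lookup (evalL false (par L1 L2))) tops)) m
      ≡⟨ ≡.cong (λ E → coeff (sumE (map (Vec.lookup E) tops)) m) (par-eval false L1 L2) ⟩
    coeff (sumE (map (Vec.lookup (E1 Vec.++ E2)) tops)) m
      ≡⟨ ≡.cong (λ z → coeff (sumE z) m) (LP.map-++ (Vec.lookup (E1 Vec.++ E2)) (map (_↑ˡ w2) t1) (map (w1 ↑ʳ_) t2)) ⟩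
    coeff (sumE (map (Vec.lookup (E1 Vec.++ E2)) (map (_↑ˡ w2) t1) ++ map (Vec.lookup (E1 Vec.++ E2)) (map (w1 ↑ʳ_) t2))) m
      ≈⟨ sumE-++ (map (Vec.lookup (E1 Vec.++ E2)) (map (_↑ˡ w2) t1)) _ m ⟩
    coeff (sumE (map (Vec.lookup (E1 Vec.++ E2)) (map (_↑ˡ w2) t1))) m + coeff (sumE (map (Vec.lookup (E1 Vec.++ E2)) (map (w1 ↑ʳ_) t2))) m
      ≡⟨ ≡.cong₂ (λ x y → coeff (sumE x) m + coeff (sumE y) m)
           (≡.trans (≡.sym (LP.map-∘ t1)) (LP.map-cong (VP.lookup-++ˡ E1 E2) t1))
           (≡.trans (≡.sym (LP.map-∘ t2)) (LP.map-cong (VP.lookup-++ʳ E1 E2) t2)) ⟩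
    coeff (sumE (map (Vec.lookup E1) t1)) m + coeff (sumE (map (Vec.lookup E2) t2)) m ∎
    where
    E1 : Vec (Expr n) w1
    E1 = evalL false L1
    E2 : Vec (Expr n) w2
    E2 = evalL false L2
    tops : List (Fin (w1 ℕ.+ w2))
    tops = map (_↑ˡ w2) t1 ++ map (w1 ↑ʳ_) t2

  summandsSize-combine : ∀ {n D} (p q : Summands n D) → summandsSize (combine p q) ≡ summandsSize p ℕ.+ summandsSize q
  summandsSize-combine (w1 , L1 , t1) (w2 , L2 , t2) rewrite par-size L1 L2
    | LP.length-++ (map (_↑ˡ w2) t1) {map (w1 ↑ʳ_) t2} | LP.length-map (_↑ˡ w2) t1 | LP.length-map (w1 ↑ʳ_) t2 =
    +-interchangeℕ (size L1) (size L2) (List.length t1) (List.length t2)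

  noSummands : ∀ {n} D → Summands n D
  noSummands D = 0 , emptyL D , []

  combineAll : ∀ {n D} (k : ℕ) → (ℕ → Summands n D) → Summands n D
  combineAll {D = D} zero f = noSummands D
  combineAll (suc k) f = combine (f 0) (combineAll k (f ∘ suc))

  value-combineAll : ∀ {n D} (k : ℕ) (f : ℕ → Summands n D) m → value (combineAll k f) m ≈ ∑ k (λ i → value (f i) m)
  value-combineAll zero f m = trans (constP-0 m) (sym (∑-zero _))
  value-combineAll (suc k) f m =
    trans (value-combine (f 0) (combineAll k (f ∘ suc)) m)
          (trans (+-cong refl (value-combineAll k (f ∘ suc) m)) (sym (∑-suc k _)))

  size-combineAll : ∀ {n D} (k : ℕ) (f : ℕ → Summands n D) X → (∀ i → i < k → summandsSize (f i) ≤ X) → summandsSize (combineAll k f) ≤ k ℕ.* X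
  size-combineAll {D = D} zero f X h = NP.≤-reflexive (≡.trans (NP.+-identityʳ _) (emptyL-size D))
  size-combineAll (suc k) f X h =
    NP.≤-trans (NP.≤-reflexive (summandsSize-combine (f 0) (combineAll k (f ∘ suc))))
               (NP.+-mono-≤ (h 0 (s≤s z≤n)) (size-combineAll k (f ∘ suc) X (λ i lt → h (suc i) (s≤s lt))))

  module Copies {n D w} (L : Layers (suc n) (suc D) w) (g : List⁺ (Fin w)) where
    top : Expr (suc n)
    top = sumE (map (Vec.lookup (evalL false L)) (toList g))

    sum-scaled : ∀ {u} (E'' E' : Vec (Expr n) u) c → (∀ j → coeff (Vec.lookup E'' j) ≐ λ m → c * coeff (Vec.lookup E' j) m) →
      ∀ xs m → coeff (sumE (map (Vec.lookup E'') xs)) m ≈ c * coeff (sumE (map (Vec.lookup E') xs)) m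
    sum-scaled E'' E' c h [] m = trans (constP-0 m) (sym (trans (*-cong refl (constP-0 m)) (zeroʳ c)))
    sum-scaled E'' E' c h (x ∷ xs) m = trans (+-cong (h x m) (sum-scaled E'' E' c h xs m)) (sym (distribˡ c _ _))

    copy : ℕ → C → C → Summands n (suc D)
    copy t β c = w , scale c (Rewire.rewire t β false L) , toList g

    copy-value : ∀ t β c m → value (copy t β c) m ≈ c * Specialisation.specialise (embℕ (suc t)) β (degBound top) (coeff top) m
    copy-value t β c m =
      trans (sum-scaled (evalL false (scale c (rewire false L))) (evalL false (rewire false L)) c
                        (scale-sem c (rewire false L)) (toList g) m)
            (*-cong refl (sum-specialises (evalL false (rewire false L)) (evalL false L) (rewire-specialises false L) (toList g) m))
      where open Rewire t β

    copy-size : ∀ t β c → summandsSize (copy t β c) ≤ D ℕ.+ 2 ℕ.* (suc (suc t) ℕ.* size L) ℕ.+ List⁺.length g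
    copy-size t β c = ≡.subst (λ z → summandsSize (copy t β c) ≤ D ℕ.+ 2 ℕ.* (suc (suc t) ℕ.* size L) ℕ.+ z) (length-toList g)
      (NP.+-monoˡ-≤ (List.length (toList g))
        (NP.≤-trans (scale-size c (Rewire.rewire t β false L)) (NP.+-monoʳ-≤ D (NP.*-monoʳ-≤ 2 (Rewire.rewire-size t β false L)))))
      where
      length-toList : ∀ {A : Set} (g : List⁺ A) → List.length (toList g) ≡ List⁺.length g
      length-toList (x ∷ xs) = ≡.refl

  -- The circuit for g_J when P has a circuit L ▷ [g] of depth ≥ 2: combine the (r + 1)²
  -- scaled rewired copies prescribed by the interpolation formula.
  module Assemble (cz : CharZero) {n} (P : Expr (suc n)) (r : ℕ) (deg : DegAtMost (coeff P) r) (α : C) (d J : ℕ) (J≤r : J ≤ r)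
                  {D w} (L : Layers (suc n) (suc D) w) (g : List⁺ (Fin w))
                  (computesP : coeff (sumE (map (Vec.lookup (evalL false L)) (toList g))) ≐ coeff P) where
    open Interpolation cz P r deg α d J J≤r using (μ; ν; dilatedShift; interpolant; gElem-interpolation)
    open Copies L g

    summand : ℕ → ℕ → Summands n (suc D)
    summand t b = copy t (α + embℕ b) (μ t * ν b)

    assembled : Summands n (suc D)
    assembled = combineAll (suc r) (λ t → combineAll (suc r) (summand t))

    specialised-top : ∀ t b m → Specialisation.specialise (embℕ (suc t)) (α + embℕ b) (degBound top) (coeff top) m ≈ dilatedShift m t b
    specialised-top t b m = *-cong refl (trans (evalHead-cong β (degBound top) computesP m)
      (evalHead-limits β (degBound top) r (λ m' lt → trans (sym (computesP m')) (deg-coeff top m' lt)) deg m))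
      where
      β : C
      β = α + embℕ b

    assembled-value : ∀ m → value assembled m ≈ gElem P α d J m
    assembled-value m = begin
      value assembled m
        ≈⟨ value-combineAll (suc r) (λ t → combineAll (suc r) (summand t)) m ⟩
      ∑ (suc r) (λ t → value (combineAll (suc r) (summand t)) m)
        ≈⟨ ∑-cong' (suc r) (λ t → value-combineAll (suc r) (summand t) m) ⟩
      ∑ (suc r) (λ t → ∑ (suc r) (λ b → value (summand t b) m))
        ≈⟨ ∑-cong' (suc r) (λ t → ∑-cong' (suc r) (λ b →
             trans (copy-value t (α + embℕ b) (μ t * ν b) m) (*-cong refl (specialised-top t b m)))) ⟩
      interpolant m
        ≈⟨ sym (gElem-interpolation m) ⟩
      gElem P α d J m ∎

    copyBound : ℕ
    copyBound = D ℕ.+ 2 ℕ.* (suc (suc r) ℕ.* size L) ℕ.+ List⁺.length g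

    assembled-size : summandsSize assembled ≤ suc r ℕ.* (suc r ℕ.* copyBound)
    assembled-size = size-combineAll (suc r) (λ t → combineAll (suc r) (summand t)) (suc r ℕ.* copyBound) λ t t≤r →
      size-combineAll (suc r) (summand t) copyBound λ b _ →
        NP.≤-trans (copy-size t (α + embℕ b) (μ t * ν b))
          (NP.+-monoˡ-≤ (List⁺.length g) (NP.+-monoʳ-≤ D (NP.*-monoʳ-≤ 2 (NP.*-monoˡ-≤ (size L) (s≤s (s≤s (NP.≤-pred t≤r)))))))

  -- Circuits of depth ≤ 1 compute sums of leaves, i.e. polynomials of degree ≤ 1.  Then
  -- h_j has no coefficient of positive degree for j ≥ 1, so g_J = 0 for J ≥ 1, while g_0 is
  -- the linear part: the same sum of leaves with y and the constants replaced by 0.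
  linearLeaf : ∀ {n} → Leaf (suc n) → Leaf n
  linearLeaf (lvar (suc i)) = lvar i
  linearLeaf (lvar zero) = lcon 0#
  linearLeaf (lcon _) = lcon 0#

  module Affine (cz : CharZero) {n} (xs : List (Leaf (suc n))) (P : Expr (suc n)) (isSum : coeff P ≐ coeff (sumE (map leafE xs)))
                (α : C) (d : ℕ) (d≥1 : 1 ≤ d) where
    linearPart : Coeffs n
    linearPart = coeff (sumE (map (leafE ∘ linearLeaf) xs))

    degBound-leaves : ∀ (ys : List (Leaf (suc n))) → degBound (sumE (map leafE ys)) ≤ 1
    degBound-leaves [] = z≤n
    degBound-leaves (lvar _ ∷ ys) = NP.⊔-lub NP.≤-refl (degBound-leaves ys)
    degBound-leaves (lcon _ ∷ ys) = NP.⊔-lub z≤n (degBound-leaves ys)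

    degBound-linear : ∀ (ys : List (Leaf (suc n))) → degBound (sumE (map (leafE ∘ linearLeaf) ys)) ≤ 1
    degBound-linear [] = z≤n
    degBound-linear (lvar (suc _) ∷ ys) = NP.⊔-lub NP.≤-refl (degBound-linear ys)
    degBound-linear (lvar zero ∷ ys) = NP.⊔-lub z≤n (degBound-linear ys)
    degBound-linear (lcon _ ∷ ys) = NP.⊔-lub z≤n (degBound-linear ys)

    deg-P : DegAtMost (coeff P) 1
    deg-P m lt = trans (isSum m) (deg-mono (degBound-leaves xs) (deg-coeff (sumE (map leafE xs))) m lt)

    deg-linearPart : DegAtMost linearPart 1
    deg-linearPart = deg-mono (degBound-linear xs) (deg-coeff (sumE (map (leafE ∘ linearLeaf) xs)))

    positive-coeffs : ∀ (ys : List (Leaf (suc n))) m → 1 ≤ ∣ m ∣ →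
      coeff (sumE (map leafE ys)) (0 ∷ m) ≈ coeff (sumE (map (leafE ∘ linearLeaf) ys)) m
    positive-coeffs [] m le = refl
    positive-coeffs (lvar (suc i) ∷ ys) m le = +-cong refl (positive-coeffs ys m le)
    positive-coeffs (lvar zero ∷ ys) m le = +-cong (sym (constP-0 m)) (positive-coeffs ys m le)
    positive-coeffs (lcon c ∷ ys) m le with allZero m in eq
    ... | true = ⊥-elim (NP.<⇒≢ le (≡.sym (allZero⇒0 m eq)))
    ... | false = +-cong refl (positive-coeffs ys m le)

    open HasseVanishing cz P 1 deg-P α using (h≈expanded; h-beyond; B)

    hasse-positive : ∀ m j → 1 ≤ ∣ m ∣ → hasseAt j P α m ≈ coeff P (0 ∷ m) * δ 0 j
    hasse-positive m j le with j ℕ.≤? B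
    ... | yes j≤B = trans (h≈expanded m j j≤B) (trans (∑-suc B _) (trans (+-cong refl
           (∑-0 B (λ e _ → trans (*-cong (deg-P (suc e ∷ m) (s≤s (NP.≤-trans le (NP.m≤n+m _ e)))) refl) (zeroˡ _)))) (+-identityʳ _)))
    ... | no j≰B = trans (h-beyond m j (NP.≰⇒> j≰B)) (sym (trans (*-cong refl (δ-ne 0 j j≢0)) (zeroʳ _)))
      where
      j≢0 : j ≢ 0
      j≢0 e = j≰B (≡.subst (_≤ B) (≡.sym e) z≤n)

    constant-free : ∀ (ys : List (Leaf (suc n))) m → ∣ m ∣ ≡ 0 → coeff (sumE (map (leafE ∘ linearLeaf) ys)) m ≈ 0#
    constant-free [] m e = constP-0 m
    constant-free (lvar (suc i) ∷ ys) m e = trans (+-cong notUnit (constant-free ys m e)) (+-identityʳ 0#)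
      where
      notUnit : varP i m ≈ 0#
      notUnit with isUnit i m in u
      ... | true = ⊥-elim (NP.0≢1+n (≡.trans (≡.sym e) (isUnit⇒1 i m u)))
      ... | false = refl
    constant-free (lvar zero ∷ ys) m e = trans (+-cong (constP-0 m) (constant-free ys m e)) (+-identityʳ 0#)
    constant-free (lcon _ ∷ ys) m e = trans (+-cong (constP-0 m) (constant-free ys m e)) (+-identityʳ 0#)

    g₀-linear : ∀ m → gElem P α d 0 m ≈ linearPart m
    g₀-linear m = begin
      gElem P α d 0 m                    ≈⟨ gElem-window P α d 0 m ⟩
      window d ∣ m ∣ * hasseAt 0 P α m   ≈⟨ window-positive d ∣ m ∣ (λ le → trans (hasse-positive m 0 le)
                                              (trans (*-cong refl (δ-self 0)) (trans (*-identityʳ _) (trans (isSum (0 ∷ m)) (positive-coeffs xs m le))))) ⟩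
      window d ∣ m ∣ * linearPart m      ≈⟨ window-affine d d≥1 ∣ m ∣ (linearPart m) (constant-free xs m) (deg-linearPart m) ⟩
      linearPart m                       ∎

    g-vanishes : ∀ J → 1 ≤ J → ∀ m → gElem P α d J m ≈ 0#
    g-vanishes J J≥1 m = begin
      gElem P α d J m                    ≈⟨ gElem-window P α d J m ⟩
      window d ∣ m ∣ * hasseAt J P α m   ≈⟨ window-positive d ∣ m ∣ (λ le → trans (hasse-positive m J le) (trans (*-cong refl (δ-ne 0 J J≢0)) (zeroʳ _))) ⟩
      window d ∣ m ∣ * 0#                ≈⟨ zeroʳ _ ⟩
      0#                                 ∎
      where
      J≢0 : J ≢ 0
      J≢0 e = NP.<⇒≢ J≥1 (≡.sym e)

  -- Arithmetic of the size bound: with r ≥ 1, sL + |g| ≤ s and D ≤ sL,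
  --   (r + 1)² (D + 2 (r + 2) sL + |g|) ≤ (r + 1)² (2r + 5) s ≤ 32 s r⁴.
  quartic-slack : ∀ r' s → 32 ℕ.* s ℕ.* (suc r' ℕ.* (suc r' ℕ.* (suc r' ℕ.* (suc r' ℕ.* 1)))) ≡
    suc (suc r') ℕ.* (suc (suc r') ℕ.* (s ℕ.+ 2 ℕ.* (suc (suc (suc r')) ℕ.* s)))
    ℕ.+ s ℕ.* (32 ℕ.* (r' ℕ.* r' ℕ.* r' ℕ.* r') ℕ.+ 126 ℕ.* (r' ℕ.* r' ℕ.* r') ℕ.+ 177 ℕ.* (r' ℕ.* r') ℕ.+ 92 ℕ.* r' ℕ.+ 4)
  quartic-slack = solve-∀

  assembled-bound : ∀ r s D sL lg → 1 ≤ r → sL ℕ.+ lg ≤ s → D ≤ sL →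
    suc r ℕ.* (suc r ℕ.* (D ℕ.+ 2 ℕ.* (suc (suc r) ℕ.* sL) ℕ.+ lg)) ≤ 32 ℕ.* s ℕ.* r ^ 4
  assembled-bound r@(suc r') s D sL lg _ sL+lg≤s D≤sL =
    NP.≤-trans (NP.*-monoʳ-≤ (suc r) (NP.*-monoʳ-≤ (suc r) copies≤))
               (NP.≤-trans (NP.m≤m+n _ _) (NP.≤-reflexive (≡.sym (quartic-slack r' s))))
    where
    copies≤ : D ℕ.+ 2 ℕ.* (suc (suc r) ℕ.* sL) ℕ.+ lg ≤ s ℕ.+ 2 ℕ.* (suc (suc r) ℕ.* s)
    copies≤ = NP.≤-trans (NP.≤-reflexive (swap23 D (2 ℕ.* (suc (suc r) ℕ.* sL)) lg))
      (NP.+-mono-≤ (NP.≤-trans (NP.+-monoˡ-≤ lg D≤sL) sL+lg≤s)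
                   (NP.*-monoʳ-≤ 2 (NP.*-monoʳ-≤ (suc (suc r)) (NP.≤-trans (NP.m≤m+n sL lg) sL+lg≤s))))
      where
      swap23 : ∀ x y z → x ℕ.+ y ℕ.+ z ≡ x ℕ.+ z ℕ.+ y
      swap23 = solve-∀

  s≤bound : ∀ r s → 1 ≤ r → s ≤ 32 ℕ.* s ℕ.* r ^ 4
  s≤bound (suc r') s _ = NP.≤-trans (NP.m≤n*m s 32) (NP.≤-trans (NP.≤-reflexive (≡.sym (NP.*-identityʳ (32 ℕ.* s))))
                           (NP.*-monoʳ-≤ (32 ℕ.* s) (NP.m^n>0 (suc r') 4)))

  module MainParts (cz : CharZero) {n} (P : Expr (suc n)) (r : ℕ) (deg : DegAtMost (coeff P) r) (α : C) (d : ℕ) (d≥1 : 1 ≤ d) where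
    open HasseVanishing cz P r deg α using (hasse-vanishes)

    -- (1): the window kills all monomials of degree 0 or > d
    monomial-degrees : ∀ g → g ∈G[ P , α , d ] → ∀ m → ¬ (g m ≈ 0#) → 1 ≤ ∣ m ∣ × ∣ m ∣ ≤ d
    monomial-degrees g ((j , _ , g≐) , _) m gm≉0 with ∣ m ∣ ℕ.≤? d | ∣ m ∣ ℕ.≟ 0
    ... | _ | yes e = ⊥-elim (gm≉0 (trans (g≐ m) (trans (gElem-window P α d j m)
                        (trans (*-cong (trans (reflexive (≡.cong (window d) e)) (window-0 d)) refl) (zeroˡ _)))))
    ... | no nle | no _ = ⊥-elim (gm≉0 (trans (g≐ m) (trans (gElem-window P α d j m)
                            (trans (*-cong (window-above d ∣ m ∣ (NP.≰⇒> nle)) refl) (zeroˡ _)))))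
    ... | yes le | no ne = NP.n≢0⇒n>0 ne , le

    G-covered : CardAtMost (λ g → g ∈G[ P , α , d ]) (suc d)
    G-covered = (λ i → gElem P α d (toℕ i)) , λ where
      g ((j , j≤d , g≐) , _) → fromℕ< (s≤s j≤d) ,
        λ m → trans (g≐ m) (reflexive (≡.cong (λ z → gElem P α d z m) (≡.sym (FP.toℕ-fromℕ< (s≤s j≤d)))))

    nonzero⇒J≤r : ∀ {g} J → g ≐ gElem P α d J → NonZero g → J ≤ r
    nonzero⇒J≤r J g≐ nz with J ℕ.≤? r
    ... | yes le = le
    ... | no nle = ⊥-elim (nz λ m → trans (g≐ m) (trans (gElem-window P α d J m)
                     (trans (*-cong refl (hasse-vanishes m J (inj₁ (NP.≰⇒> nle)))) (zeroʳ _))))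

    -- (if r = 0, all h_J vanish in positive degree)
    nonzero⇒1≤r : ∀ {g} J → g ≐ gElem P α d J → NonZero g → 1 ≤ r
    nonzero⇒1≤r J g≐ nz with r ℕ.≟ 0
    ... | no ne = NP.n≢0⇒n>0 ne
    ... | yes r≡0 = ⊥-elim (nz λ m → trans (g≐ m) (trans (gElem-window P α d J m)
                      (trans (window-positive d ∣ m ∣ (λ le → hasse-vanishes m J (inj₂ (≡.subst (_< ∣ m ∣) (≡.sym r≡0) le))))
                             (zeroʳ _))))

    affine-g : ∀ xs → coeff P ≐ coeff (sumE (map leafE xs)) → ∀ {g} J → g ≐ gElem P α d J → NonZero g →
      g ≐ coeff (sumE (map (leafE ∘ linearLeaf) xs))
    affine-g xs isSum J g≐ nz with J ℕ.≟ 0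
    ... | yes ≡.refl = λ m → trans (g≐ m) (g₀-linear m)
      where open Affine cz xs P isSum α d d≥1
    ... | no J≢0 = ⊥-elim (nz (λ m → trans (g≐ m) (g-vanishes J (NP.n≢0⇒n>0 J≢0) m)))
      where open Affine cz xs P isSum α d d≥1

    circuits : ∀ s Δ → HasCircuit (coeff P) s Δ → ∀ g → g ∈G[ P , α , d ] → HasCircuit g (32 ℕ.* s ℕ.* r ^ 4) Δ
    circuits s Δ (circ , size≤s , computesP) g ((J , _ , g≐) , nz) = byDepth Δ circ size≤s computesP
      where
      1≤r : 1 ≤ r
      1≤r = nonzero⇒1≤r J g≐ nz

      byDepth : ∀ Δ (circ : Circuit (suc n) Δ) → size circ ≤ s → coeff (evalC circ) ≐ coeff P → HasCircuit g (32 ℕ.* s ℕ.* r ^ 4) Δ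
      byDepth zero (leaves (l ∷ [])) _ computesP =
        leaves (linearLeaf l ∷ []) , z≤n , λ m → sym (trans (linear≐ m) (trans (+-cong refl (constP-0 m)) (+-identityʳ _)))
        where
        linear≐ : g ≐ coeff (sumE (map (leafE ∘ linearLeaf) (l ∷ [])))
        linear≐ = affine-g (l ∷ []) (λ m → sym (trans (+-cong refl (constP-0 m)) (trans (+-identityʳ _) (computesP m)))) J g≐ nz
      byDepth (suc zero) (leaves ls ▷ (g0 ∷ [])) size≤s computesP =
        (leaves (Vec.map linearLeaf ls) ▷ (g0 ∷ [])) , NP.≤-trans size≤s (s≤bound r s 1≤r) ,
        λ m → sym (trans (affine-g xs (λ m → trans (sym (computesP m)) (reflexive (≡.cong (λ z → coeff (sumE z) m) lookups))) J g≐ nz m)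
                         (reflexive (≡.cong (λ z → coeff (sumE z) m) linearLookups)))
        where
        xs : List (Leaf (suc n))
        xs = map (Vec.lookup ls) (toList g0)
        lookups : map (Vec.lookup (Vec.map leafE ls)) (toList g0) ≡ map leafE xs
        lookups = ≡.trans (LP.map-cong (λ i → VP.lookup-map i leafE ls) (toList g0)) (LP.map-∘ (toList g0))
        linearLookups : map (leafE ∘ linearLeaf) xs ≡ map (Vec.lookup (Vec.map leafE (Vec.map linearLeaf ls))) (toList g0)
        linearLookups = ≡.sym (≡.trans (LP.map-cong (λ i → ≡.trans (VP.lookup-map i leafE (Vec.map linearLeaf ls))
                                                                    (≡.cong leafE (VP.lookup-map i linearLeaf ls))) (toList g0))
                                       (LP.map-∘ (toList g0)))
      byDepth (suc (suc D)) (L ▷ (g0 ∷ [])) size≤s computesP = fromSummands assembled assembled-value assembled-size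
        where
        open Assemble cz P r deg α d J (nonzero⇒J≤r J g≐ nz) L g0 computesP
        topSize : ∀ {k D w} (L : Layers k D w) (g0 : List⁺ (Fin w)) → size (L ▷ (g0 ∷ [])) ≡ size L ℕ.+ List⁺.length g0
        topSize L g0 = ≡.cong (size L ℕ.+_) (NP.+-identityʳ _)
        bound : suc r ℕ.* (suc r ℕ.* copyBound) ≤ 32 ℕ.* s ℕ.* r ^ 4
        bound = assembled-bound r s D (size L) (List⁺.length g0) 1≤r (NP.≤-trans (NP.≤-reflexive (≡.sym (topSize L g0))) size≤s)
                  (NP.≤-trans (NP.n≤1+n D) (depth≤size L (List⁺.head g0)))
        -- a final sum gate over the summands; there is at least one, as g is nonzero
        fromSummands : (p : Summands n (suc D)) → (∀ m → value p m ≈ gElem P α d J m) → summandsSize p ≤ suc r ℕ.* (suc r ℕ.* copyBound) →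
          HasCircuit g (32 ℕ.* s ℕ.* r ^ 4) (suc (suc D))
        fromSummands (w , L' , []) val _ = ⊥-elim (nz λ m → trans (g≐ m) (trans (sym (val m)) (constP-0 m)))
        fromSummands (w , L' , x ∷ xs) val size≤ =
          (L' ▷ ((x ∷ xs) ∷ [])) , NP.≤-trans (NP.≤-reflexive (topSize L' (x ∷ xs))) (NP.≤-trans size≤ bound) ,
          λ m → trans (val m) (sym (g≐ m))

lemma5p2 : ∀ {a ℓ : Level} → Σ ℕ λ c →
    (F : Field a ℓ) → let open Poly F in
    CharZero →
    (n : ℕ) (P : Expr (suc n)) (r : ℕ) → DegAtMost (coeff P) r →
    (α : C) (d : ℕ) → 1 ≤ d →
    (∀ g → g ∈G[ P , α , d ] → ∀ m → ¬ (g m ≈ 0#) → 1 ≤ ∣ m ∣ × ∣ m ∣ ≤ d)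
    × CardAtMost (λ g → g ∈G[ P , α , d ]) (suc d)
    × (∀ s Δ → HasCircuit (coeff P) s Δ →
    ∀ g → g ∈G[ P , α , d ] → HasCircuit g (c ℕ.* s ℕ.* r ^ 4) Δ)
lemma5p2 = 32 , λ F cz n P r deg α d d≥1 →
  let open Development.MainParts F cz P r deg α d d≥1 in
  monomial-degrees , G-covered , circuits
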